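{- Let $\mathcal A$ and $\mathcal B$ be labeled combinatorial classes with $\mathcal A=\mathrm{SEQ}(\mathcal B)$, such that the counting sequence $(\mathfrak a_n)$ of $\mathcal A$ is $p$-periodic for some positive integer $p$ and $\big(\mathfrak a_{pn}/(pn)!\big)_n$ is gargantuan. Suppose moreover that $\mathfrak a_p\neq0$. Then for every positive integer $m$, for a uniformly random object $a\in\mathcal A$ of size $pn$, \[ \mathbb P(a\text{ has }m\text{ irreducible parts})=m\,\frac{(pn)!}{(p!)^{m-1}\,(p(n-m+1))!}\cdot\frac{\mathfrak a_p^{m-1}\mathfrak a_{p(n-m+1)}}{\mathfrak a_{pn}}+O\Big(n^{pm}\frac{\mathfrak a_{p(n-m)}}{\mathfrak a_{pn}}\Big). \]
   Context: A labeled combinatorial class is a collection of objects of finite size $n$ with atoms labeled bijectively by $[n]$, stable under relabeling, with $\mathfrak a_n$ objects of size $n$; EGF $\sum\mathfrak a_nz^n/n!$. For a labeled class $\mathcal B$ with $\mathfrak b_0=0$, $\mathcal B^m$ is the labeled product of $m$ copies (EGF $B(z)^m$) and $\mathrm{SEQ}(\mathcal B)=\sum_{m\ge0}\mathcal B^m$; an object of $\mathrm{SEQ}(\mathcal B)$ lying in $\mathcal B^m$ has $m$ ($\mathrm{SEQ}$-)irreducible parts. A sequence $(\mathfrak a_n)$ is $p$-periodic if $\mathfrak a_n\neq0$ for $n=pk$ with $k$ sufficiently large and $\mathfrak a_n=0$ for all other $n$. A sequence $(a_n)$ is gargantuan if $a_{n-1}/a_n\to0$ and for every positive integer $r$, $\sum_{k=r}^{n-r}|a_ka_{n-k}|=O(a_{n-r})$.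 Random objects of a given size are uniform. -}

module Defs where

open import Data.Nat using (ℕ; zero; suc; _+_; _*_; _∸_; _^_; _≤_; _≥_; _>_)
open import Data.Nat.Combinatorics using (_C_)
open import Data.Nat.Divisibility using (_∣_)
open import Data.Integer using (+_)
open import Data.Rational using (ℚ; 0ℚ; _/_; 1/_; ≢-nonZero; ∣_∣) renaming (_*_ to _*ℚ_; _+_ to _+ℚ_; _≤_ to _≤ℚ_; _<_ to _<ℚ_)
open import Data.Rational.Properties using (_≟_)
open import Data.Product using (Σ; ∃; _×_; _,_)
open import Relation.Nullary using (¬_; yes; no)
open import Relation.Binary.PropositionalEquality using (_≡_; _≢_)

-- A labeled class is represented through its counting sequence 𝔟 : ℕ → ℕ
-- (𝔟 n = number of objects of size n).

sumTo : ℕ → (ℕ → ℕ) → ℕ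
sumTo zero    f = f 0
sumTo (suc n) f = sumTo n f + f (suc n)

sumℚFromTo : ℕ → ℕ → (ℕ → ℚ) → ℚ
sumℚFromTo a b f with b Data.Nat.<? a
... | yes _ = 0ℚ
... | no  _ = go (b ∸ a)
  where
  go : ℕ → ℚ
  go zero    = f a
  go (suc i) = go i +ℚ f (a + suc i)

-- counting sequence of the labeled product 𝓑^m :
--   𝓑^0 has a single object (of size 0);
--   (𝓑^{m+1})_n = ∑_k C(n,k) 𝔟_k (𝓑^m)_{n-k}
powCount : (ℕ → ℕ) → ℕ → ℕ → ℕ
powCount b zero    zero    = 1
powCount b zero    (suc n) = 0
powCount b (suc m) n       = sumTo n (λ k → (n C k) * b k * powCount b m (n ∸ k))

-- counting sequence of SEQ(𝓑) = ∑_{m ≥ 0} 𝓑^m ; when 𝔟_0 = 0, (𝓑^m)_n = 0 for m > n,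
-- so the sum may be truncated at m = n.
seqCount : (ℕ → ℕ) → ℕ → ℕ
seqCount b n = sumTo n (λ m → powCount b m n)

ℕ→ℚ : ℕ → ℚ
ℕ→ℚ n = (+ n) / 1

-- total division (x / 0 := 0); only used where denominators are eventually nonzero
_÷'_ : ℚ → ℚ → ℚ
x ÷' y with y ≟ 0ℚ
... | yes _ = 0ℚ
... | no y≢0 = x *ℚ (1/_ y {{≢-nonZero y≢0}})

Periodic : ℕ → (ℕ → ℕ) → Set
Periodic p a =
  (Σ ℕ λ K → ∀ k → k ≥ K → a (p * k) ≢ 0) ×
  (∀ n → ¬ (p ∣ n) → a n ≡ 0)

Gargantuan : (ℕ → ℚ) → Set
Gargantuan s =
  (∀ ε → 0ℚ <ℚ ε → Σ ℕ λ N → ∀ n → n ≥ N → ∣ s (n ∸ 1) ÷' s n ∣ <ℚ ε) ×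
  (∀ r → r ≥ 1 → Σ ℚ λ C → Σ ℕ λ N → ∀ n → n ≥ N →
      sumℚFromTo r (n ∸ r) (λ k → ∣ s k *ℚ s (n ∸ k) ∣) ≤ℚ C *ℚ ∣ s (n ∸ r) ∣)

-- Normalise by factorials: β j = 𝔟_{pj}/(pj)!, s j = 𝔞_{pj}/(pj)!, and likewise for 𝓑^m.
-- Since 𝔟 ≤ 𝔞 termwise, periodicity makes 𝔟 vanish off pℕ, and the labelled products
-- become ordinary convolutions: the m-th power is the convolution power β^{*m}, and
-- s = 1 + β * s.  With c = β 1 = s 1 > 0, induction on k gives
--   β^{*(k+1)} (k + 1 + t) = (k + 1) cᵏ s (t + 1) + O(s t).
-- In the step, the convolution β * β^{*(k+1)} at k + 2 + t splits into the term i = 1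
-- (c times the previous error), the term i = t + 1 (whose difference from the main term is
-- -c^{k+1} (s (t + 1) - β (t + 1))), and a middle sum.  Both s (t + 1) - β (t + 1) and the
-- middle sum are dominated by convolution sums Σ s i s (n - i) over r ≤ i ≤ n - r, which
-- the gargantuan hypothesis bounds by O(s t).  Multiplying back by (pn)!/𝔞_{pn} and using
-- (pn)! ≤ (pn)^{pm} (p(n - m))! gives the statement.

{-# OPTIONS --safe #-}
module Submission where

open import Defs
open import Data.Nat using (ℕ; _+_; _*_; _∸_; _^_; _≥_; _>_; _!)
open import Data.Rational using (ℚ; ∣_∣) renaming (_*_ to _*ℚ_; _-_ to _-ℚ_; _≤_ to _≤ℚ_)
open import Data.Product using (Σ)
open import Relation.Binary.PropositionalEquality using (_≡_; _≢_)

open import Algebra.Bundles using (CommutativeRing)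
open import Data.Empty using (⊥-elim)
open import Data.Nat using (zero; suc; _≤_; _<_; _<?_; _⊔_; z≤n; s≤s)
import Data.Nat.Coprimality as Coprimality
open import Data.Nat.Combinatorics using (_C_; nCk≡n!/k![n-k]!; k![n∸k]!∣n!; nCn≡1)
open import Data.Nat.Divisibility using (_∣_; ∣m+n∣m⇒∣n; ∣⇒≤; m∣m*n)
open import Data.Nat.DivMod using (m/n*n≡m)
import Data.Nat.Properties as ℕ
open import Data.Product using (_×_; _,_; proj₂)
open import Data.Rational using (0ℚ; 1ℚ; mkℚ; -_; 1/_; positive; nonNegative; ≢-nonZero)
  renaming (_+_ to _+ℚ_; _<_ to _<ℚ_)
import Data.Rational.Properties as ℚ
open import Data.Rational.Solver using (module +-*-Solver)
open import Relation.Nullary using (¬_; Dec; yes; no)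
open import Relation.Binary.PropositionalEquality
  using (refl; sym; trans; cong; cong₂; subst; subst₂; module ≡-Reasoning)

open +-*-Solver using (solve; _:+_; _:*_; _:-_; :-_; _:=_; con)
open import Algebra.Properties.CommutativeSemigroup ℕ.*-commutativeSemigroup
  using () renaming (interchange to *-interchange)
open import Algebra.Properties.CommutativeSemiring.Exp (CommutativeRing.commutativeSemiring ℚ.+-*-commutativeRing)
  using () renaming (_^_ to _^ℚ_; ^-distrib-* to ^ℚ-distrib-*)

*-nonneg : ∀ {x y} → 0ℚ ≤ℚ x → 0ℚ ≤ℚ y → 0ℚ ≤ℚ x *ℚ y
*-nonneg {x} {y} 0≤x 0≤y =
  ℚ.nonNegative⁻¹ _ {{ℚ.nonNeg*nonNeg⇒nonNeg x {{nonNegative 0≤x}} y {{nonNegative 0≤y}}}}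

*-pos : ∀ {x y} → 0ℚ <ℚ x → 0ℚ <ℚ y → 0ℚ <ℚ x *ℚ y
*-pos {x} {y} 0<x 0<y = ℚ.positive⁻¹ _ {{ℚ.pos*pos⇒pos x {{positive 0<x}} y {{positive 0<y}}}}

+-nonneg : ∀ {x y} → 0ℚ ≤ℚ x → 0ℚ ≤ℚ y → 0ℚ ≤ℚ x +ℚ y
+-nonneg = ℚ.+-mono-≤

*-monoˡ-≤-nonneg : ∀ {r x y} → 0ℚ ≤ℚ r → x ≤ℚ y → r *ℚ x ≤ℚ r *ℚ y
*-monoˡ-≤-nonneg {r} 0≤r = ℚ.*-monoˡ-≤-nonNeg r {{nonNegative 0≤r}}

*-monoʳ-≤-nonneg : ∀ {r x y} → 0ℚ ≤ℚ r → x ≤ℚ y → x *ℚ r ≤ℚ y *ℚ r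
*-monoʳ-≤-nonneg {r} 0≤r = ℚ.*-monoʳ-≤-nonNeg r {{nonNegative 0≤r}}

*-mono-≤-nonneg : ∀ {a b c d} → 0ℚ ≤ℚ a → 0ℚ ≤ℚ c → a ≤ℚ b → c ≤ℚ d → a *ℚ c ≤ℚ b *ℚ d
*-mono-≤-nonneg 0≤a 0≤c a≤b c≤d =
  ℚ.≤-trans (*-monoˡ-≤-nonneg 0≤a c≤d) (*-monoʳ-≤-nonneg (ℚ.≤-trans 0≤c c≤d) a≤b)

≤-+-nonnegʳ : ∀ {x y} → 0ℚ ≤ℚ y → x ≤ℚ x +ℚ y
≤-+-nonnegʳ {x} 0≤y = subst (_≤ℚ x +ℚ _) (ℚ.+-identityʳ x) (ℚ.+-monoʳ-≤ x 0≤y)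

p≤∣p∣ : ∀ p → p ≤ℚ ∣ p ∣
p≤∣p∣ p with 0ℚ ℚ.≤? p
... | yes 0≤p = ℚ.≤-reflexive (sym (ℚ.0≤p⇒∣p∣≡p 0≤p))
... | no  p≱0 = ℚ.≤-trans (ℚ.<⇒≤ (ℚ.≰⇒> p≱0)) (ℚ.0≤∣p∣ p)

module _ where
  open import Data.Integer using (+_; +≤+) renaming (_+_ to _+ℤ_; _≤_ to _≤ℤ_)
  import Data.Integer.Properties as ℤ
  open import Data.Rational using (_/_; *≤*; ↥_)

  private
    ℕ→ℚ≡mkℚ : ∀ n → ℕ→ℚ n ≡ mkℚ (+ n) 0 (Coprimality.sym (Coprimality.1-coprimeTo n))
    ℕ→ℚ≡mkℚ n = ℚ.↥p/↧p≡p _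

  ℕ→ℚ-homo-+ : ∀ m n → ℕ→ℚ (m + n) ≡ ℕ→ℚ m +ℚ ℕ→ℚ n
  ℕ→ℚ-homo-+ m n rewrite ℕ→ℚ≡mkℚ m | ℕ→ℚ≡mkℚ n =
    cong (_/ 1) (cong₂ _+ℤ_ (sym (ℤ.*-identityʳ (+ m))) (sym (ℤ.*-identityʳ (+ n))))

  ℕ→ℚ-homo-* : ∀ m n → ℕ→ℚ (m * n) ≡ ℕ→ℚ m *ℚ ℕ→ℚ n
  ℕ→ℚ-homo-* m n rewrite ℕ→ℚ≡mkℚ m | ℕ→ℚ≡mkℚ n = cong (_/ 1) (ℤ.pos-* m n)

  ℕ→ℚ-mono-≤ : ∀ {m n} → m ≤ n → ℕ→ℚ m ≤ℚ ℕ→ℚ n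
  ℕ→ℚ-mono-≤ {m} {n} m≤n rewrite ℕ→ℚ≡mkℚ m | ℕ→ℚ≡mkℚ n =
    *≤* (subst₂ _≤ℤ_ (sym (ℤ.*-identityʳ (+ m))) (sym (ℤ.*-identityʳ (+ n))) (+≤+ m≤n))

  ℕ→ℚ-injective : ∀ {m n} → ℕ→ℚ m ≡ ℕ→ℚ n → m ≡ n
  ℕ→ℚ-injective {m} {n} eq rewrite ℕ→ℚ≡mkℚ m | ℕ→ℚ≡mkℚ n = ℤ.+-injective (cong ↥_ eq)

ℕ→ℚ-homo-^ : ∀ m n → ℕ→ℚ (m ^ n) ≡ ℕ→ℚ m ^ℚ n
ℕ→ℚ-homo-^ m zero    = refl
ℕ→ℚ-homo-^ m (suc n) = trans (ℕ→ℚ-homo-* m (m ^ n)) (cong (ℕ→ℚ m *ℚ_) (ℕ→ℚ-homo-^ m n))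

ℕ→ℚ-suc : ∀ n → ℕ→ℚ (suc n) ≡ 1ℚ +ℚ ℕ→ℚ n
ℕ→ℚ-suc n = trans (ℕ→ℚ-homo-+ 1 n) (cong (_+ℚ ℕ→ℚ n) ℕ→ℚ-1)
  where
  ℕ→ℚ-1 : ℕ→ℚ 1 ≡ 1ℚ
  ℕ→ℚ-1 = refl

ℕ→ℚ-nonneg : ∀ n → 0ℚ ≤ℚ ℕ→ℚ n
ℕ→ℚ-nonneg n = ℕ→ℚ-mono-≤ {0} {n} z≤n

ℕ→ℚ-pos : ∀ {n} → 0 < n → 0ℚ <ℚ ℕ→ℚ n
ℕ→ℚ-pos {suc n} _ = ℚ.<-≤-trans (ℚ.positive⁻¹ 1ℚ) (ℕ→ℚ-mono-≤ {1} {suc n} (s≤s z≤n))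

ℕ→ℚ-≢0 : ∀ {n} → n ≢ 0 → ℕ→ℚ n ≢ 0ℚ
ℕ→ℚ-≢0 n≢0 eq = ℚ.<-irrefl (sym eq) (ℕ→ℚ-pos (ℕ.n≢0⇒n>0 n≢0))

infix 10 _⁻¹

-- Total, like _÷'_: 0ℚ ⁻¹ = 0ℚ.
_⁻¹ : ℚ → ℚ
y ⁻¹ = 1ℚ ÷' y

÷'≡*⁻¹ : ∀ x y → x ÷' y ≡ x *ℚ y ⁻¹
÷'≡*⁻¹ x y with y ℚ.≟ 0ℚ
... | yes _ = sym (ℚ.*-zeroʳ x)
... | no  _ = cong (x *ℚ_) (sym (ℚ.*-identityˡ _))

⁻¹-inverseʳ : ∀ {y} → y ≢ 0ℚ → y *ℚ y ⁻¹ ≡ 1ℚ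
⁻¹-inverseʳ {y} y≢0 with y ℚ.≟ 0ℚ
... | yes y≡0 = ⊥-elim (y≢0 y≡0)
... | no  y≢0 = trans (cong (y *ℚ_) (ℚ.*-identityˡ _)) (ℚ.*-inverseʳ y {{≢-nonZero y≢0}})

⁻¹-nonneg : ∀ {y} → 0ℚ ≤ℚ y → 0ℚ ≤ℚ y ⁻¹
⁻¹-nonneg {y} 0≤y with y ℚ.≟ 0ℚ
... | yes _   = ℚ.≤-refl
... | no  y≢0 = ℚ.≤-trans (ℚ.<⇒≤ 0<1/y) (ℚ.≤-reflexive (sym (ℚ.*-identityˡ _)))
  where
  0<y = ℚ.nonNeg∧nonZero⇒pos y {{nonNegative 0≤y}} {{≢-nonZero y≢0}}
  0<1/y = ℚ.positive⁻¹ ((1/ y) {{≢-nonZero y≢0}}) {{ℚ.1/pos⇒pos y {{0<y}}}}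

⁻¹-pos : ∀ {y} → 0ℚ <ℚ y → 0ℚ <ℚ y ⁻¹
⁻¹-pos {y} 0<y with y ℚ.≟ 0ℚ
... | yes y≡0 = ⊥-elim (ℚ.<-irrefl (sym y≡0) 0<y)
... | no  y≢0 = ℚ.<-≤-trans 0<1/y (ℚ.≤-reflexive (sym (ℚ.*-identityˡ _)))
  where
  0<1/y = ℚ.positive⁻¹ ((1/ y) {{≢-nonZero y≢0}}) {{ℚ.1/pos⇒pos y {{positive 0<y}}}}

*-≢0 : ∀ {x y} → x ≢ 0ℚ → y ≢ 0ℚ → x *ℚ y ≢ 0ℚ
*-≢0 {x} {y} x≢0 y≢0 xy≡0 = ℚ.1≢0 (begin
  1ℚ                            ≡⟨ cong₂ _*ℚ_ (⁻¹-inverseʳ x≢0) (⁻¹-inverseʳ y≢0) ⟨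
  (x *ℚ x ⁻¹) *ℚ (y *ℚ y ⁻¹)   ≡⟨ interchange x (x ⁻¹) y (y ⁻¹) ⟩
  (x *ℚ y) *ℚ (x ⁻¹ *ℚ y ⁻¹)   ≡⟨ cong (_*ℚ (x ⁻¹ *ℚ y ⁻¹)) xy≡0 ⟩
  0ℚ *ℚ (x ⁻¹ *ℚ y ⁻¹)         ≡⟨ ℚ.*-zeroˡ (x ⁻¹ *ℚ y ⁻¹) ⟩
  0ℚ                            ∎)
  where
  open ≡-Reasoning
  interchange : ∀ a b c d → (a *ℚ b) *ℚ (c *ℚ d) ≡ (a *ℚ c) *ℚ (b *ℚ d)
  interchange = solve 4 (λ a b c d → (a :* b) :* (c :* d) := (a :* c) :* (b :* d)) refl

⁻¹-*-distrib : ∀ x y → (x *ℚ y) ⁻¹ ≡ x ⁻¹ *ℚ y ⁻¹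
⁻¹-*-distrib x y = by-cases (x ℚ.≟ 0ℚ) (y ℚ.≟ 0ℚ)
  where
  open ≡-Reasoning
  regroup : ∀ i a b c d → i *ℚ ((a *ℚ b) *ℚ (c *ℚ d)) ≡ ((a *ℚ c) *ℚ i) *ℚ (b *ℚ d)
  regroup = solve 5 (λ i a b c d → i :* ((a :* b) :* (c :* d)) := ((a :* c) :* i) :* (b :* d)) refl
  by-cases : Dec (x ≡ 0ℚ) → Dec (y ≡ 0ℚ) → (x *ℚ y) ⁻¹ ≡ x ⁻¹ *ℚ y ⁻¹
  by-cases (yes refl) _          = trans (cong _⁻¹ (ℚ.*-zeroˡ y)) (sym (ℚ.*-zeroˡ (y ⁻¹)))
  by-cases (no _)     (yes refl) = trans (cong _⁻¹ (ℚ.*-zeroʳ x)) (sym (ℚ.*-zeroʳ (x ⁻¹)))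
  by-cases (no x≢0)   (no y≢0)   = begin
    (x *ℚ y) ⁻¹                                    ≡⟨ ℚ.*-identityʳ _ ⟨
    (x *ℚ y) ⁻¹ *ℚ 1ℚ                              ≡⟨ cong ((x *ℚ y) ⁻¹ *ℚ_) cancel ⟨
    (x *ℚ y) ⁻¹ *ℚ ((x *ℚ x ⁻¹) *ℚ (y *ℚ y ⁻¹))   ≡⟨ regroup ((x *ℚ y) ⁻¹) x (x ⁻¹) y (y ⁻¹) ⟩
    ((x *ℚ y) *ℚ (x *ℚ y) ⁻¹) *ℚ (x ⁻¹ *ℚ y ⁻¹)   ≡⟨ cong (_*ℚ (x ⁻¹ *ℚ y ⁻¹)) (⁻¹-inverseʳ (*-≢0 x≢0 y≢0)) ⟩
    1ℚ *ℚ (x ⁻¹ *ℚ y ⁻¹)                           ≡⟨ ℚ.*-identityˡ _ ⟩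
    x ⁻¹ *ℚ y ⁻¹                                   ∎
    where
    cancel : (x *ℚ x ⁻¹) *ℚ (y *ℚ y ⁻¹) ≡ 1ℚ
    cancel = cong₂ _*ℚ_ (⁻¹-inverseʳ x≢0) (⁻¹-inverseʳ y≢0)

⁻¹-^-distrib : ∀ x n → (x ^ℚ n) ⁻¹ ≡ x ⁻¹ ^ℚ n
⁻¹-^-distrib x zero    = refl
⁻¹-^-distrib x (suc n) = trans (⁻¹-*-distrib x (x ^ℚ n)) (cong (x ⁻¹ *ℚ_) (⁻¹-^-distrib x n))

Σ< : ℕ → (ℕ → ℚ) → ℚ
Σ< zero    f = 0ℚ
Σ< (suc n) f = Σ< n f +ℚ f n

module _ where
  private
    weaken : ∀ {n} {P : ℕ → Set} → (∀ i → i < suc n → P i) → ∀ i → i < n → P i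
    weaken h i i<n = h i (ℕ.m<n⇒m<1+n i<n)

  Σ<-cong : ∀ n {f g} → (∀ i → i < n → f i ≡ g i) → Σ< n f ≡ Σ< n g
  Σ<-cong zero    _   = refl
  Σ<-cong (suc n) f≡g = cong₂ _+ℚ_ (Σ<-cong n (weaken f≡g)) (f≡g n ℕ.≤-refl)

  Σ<-mono-≤ : ∀ n {f g} → (∀ i → i < n → f i ≤ℚ g i) → Σ< n f ≤ℚ Σ< n g
  Σ<-mono-≤ zero    _   = ℚ.≤-refl
  Σ<-mono-≤ (suc n) f≤g = ℚ.+-mono-≤ (Σ<-mono-≤ n (weaken f≤g)) (f≤g n ℕ.≤-refl)

  Σ<-nonneg : ∀ n {f} → (∀ i → i < n → 0ℚ ≤ℚ f i) → 0ℚ ≤ℚ Σ< n f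
  Σ<-nonneg zero    _     = ℚ.≤-refl
  Σ<-nonneg (suc n) 0≤f = +-nonneg (Σ<-nonneg n (weaken 0≤f)) (0≤f n ℕ.≤-refl)

  Σ<-zero : ∀ n {f} → (∀ i → i < n → f i ≡ 0ℚ) → Σ< n f ≡ 0ℚ
  Σ<-zero zero    _   = refl
  Σ<-zero (suc n) f≡0 = cong₂ _+ℚ_ (Σ<-zero n (weaken f≡0)) (f≡0 n ℕ.≤-refl)

  term≤Σ< : ∀ n {f} → (∀ i → i < n → 0ℚ ≤ℚ f i) → ∀ {k} → k < n → f k ≤ℚ Σ< n f
  term≤Σ< (suc n) {f} 0≤f {k} k<1+n with k ℕ.≟ n
  ... | yes refl = subst (_≤ℚ Σ< n f +ℚ f n) (ℚ.+-identityˡ (f n))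
                     (ℚ.+-monoˡ-≤ (f n) (Σ<-nonneg n (weaken 0≤f)))
  ... | no  k≢n  = ℚ.≤-trans (term≤Σ< n (weaken 0≤f) (ℕ.≤∧≢⇒< (ℕ.≤-pred k<1+n) k≢n))
                     (≤-+-nonnegʳ (0≤f n ℕ.≤-refl))

Σ<-+ : ∀ m n f → Σ< (m + n) f ≡ Σ< m f +ℚ Σ< n (λ i → f (m + i))
Σ<-+ m zero    f rewrite ℕ.+-identityʳ m = sym (ℚ.+-identityʳ _)
Σ<-+ m (suc n) f rewrite ℕ.+-suc m n =
  trans (cong (_+ℚ f (m + n)) (Σ<-+ m n f)) (ℚ.+-assoc (Σ< m f) _ _)

Σ<-head : ∀ n f → Σ< (suc n) f ≡ f 0 +ℚ Σ< n (λ i → f (suc i))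
Σ<-head n f = trans (Σ<-+ 1 n f) (cong (_+ℚ Σ< n (λ i → f (suc i))) (ℚ.+-identityˡ (f 0)))

Σ<-distrib-+ : ∀ n f g → Σ< n (λ i → f i +ℚ g i) ≡ Σ< n f +ℚ Σ< n g
Σ<-distrib-+ zero    f g = refl
Σ<-distrib-+ (suc n) f g rewrite Σ<-distrib-+ n f g = interchange (Σ< n f) (Σ< n g) (f n) (g n)
  where
  interchange : ∀ a b c d → (a +ℚ b) +ℚ (c +ℚ d) ≡ (a +ℚ c) +ℚ (b +ℚ d)
  interchange = solve 4 (λ a b c d → (a :+ b) :+ (c :+ d) := (a :+ c) :+ (b :+ d)) refl

*-distribˡ-Σ< : ∀ n c f → c *ℚ Σ< n f ≡ Σ< n (λ i → c *ℚ f i)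
*-distribˡ-Σ< zero    c f = ℚ.*-zeroʳ c
*-distribˡ-Σ< (suc n) c f =
  trans (ℚ.*-distribˡ-+ c (Σ< n f) (f n)) (cong (_+ℚ c *ℚ f n) (*-distribˡ-Σ< n c f))

Σ<-swap : ∀ m n (f : ℕ → ℕ → ℚ) → Σ< m (λ i → Σ< n (f i)) ≡ Σ< n (λ j → Σ< m (λ i → f i j))
Σ<-swap zero    n f = sym (Σ<-zero n (λ _ _ → refl))
Σ<-swap (suc m) n f =
  trans (cong (_+ℚ Σ< n (f m)) (Σ<-swap m n f)) (sym (Σ<-distrib-+ n _ (f m)))

ℕ→ℚ-sumTo : ∀ n f → ℕ→ℚ (sumTo n f) ≡ Σ< (suc n) (λ i → ℕ→ℚ (f i))
ℕ→ℚ-sumTo zero    f = sym (ℚ.+-identityˡ _)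
ℕ→ℚ-sumTo (suc n) f =
  trans (ℕ→ℚ-homo-+ (sumTo n f) (f (suc n))) (cong (_+ℚ ℕ→ℚ (f (suc n))) (ℕ→ℚ-sumTo n f))

Σ<-unique : ∀ (f g : ℕ → ℚ) → g 0 ≡ f 0 → (∀ i → g (suc i) ≡ g i +ℚ f (suc i)) →
            ∀ i → g i ≡ Σ< (suc i) f
Σ<-unique f g g0≡ gsuc≡ zero    = trans g0≡ (sym (ℚ.+-identityˡ (f 0)))
Σ<-unique f g g0≡ gsuc≡ (suc i) = trans (gsuc≡ i) (cong (_+ℚ f (suc i)) (Σ<-unique f g g0≡ gsuc≡ i))

sumℚFromTo≡Σ< : ∀ a b f → a ≤ b → sumℚFromTo a b f ≡ Σ< (suc (b ∸ a)) (λ i → f (a + i))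
sumℚFromTo≡Σ< a b f a≤b with b <? a
... | yes b<a = ⊥-elim (ℕ.<⇒≱ b<a a≤b)
... | no  _ with b ∸ a | Σ<-unique (λ j → f (a + j)) _ (cong f (sym (ℕ.+-identityʳ a))) (λ _ → refl)
...   | i | go≡Σ< = go≡Σ< i

Σ<-multiples : ∀ {p} → 0 < p → ∀ j g → (∀ k → ¬ (p ∣ k) → g k ≡ 0ℚ) →
               Σ< (suc (p * j)) g ≡ Σ< (suc j) (λ i → g (p * i))
Σ<-multiples {zero}   ()
Σ<-multiples {suc p′} _ zero    g _ rewrite ℕ.*-zeroʳ p′ = refl
Σ<-multiples {suc p′} 0<p (suc j) g g≡0 = begin
  Σ< (suc (p * suc j)) g
    ≡⟨ cong (λ n → Σ< n g) (cong suc (trans (ℕ.*-suc p j) (ℕ.+-comm p (p * j)))) ⟩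
  Σ< (suc (p * j) + p) g
    ≡⟨ Σ<-+ (suc (p * j)) p g ⟩
  Σ< (suc (p * j)) g +ℚ (Σ< p′ (λ i → g (suc (p * j) + i)) +ℚ g (suc (p * j) + p′))
    ≡⟨ cong₂ _+ℚ_ (Σ<-multiples 0<p j g g≡0) (cong₂ _+ℚ_ (Σ<-zero p′ gaps≡0) (cong g last≡)) ⟩
  Σ< (suc j) (λ i → g (p * i)) +ℚ (0ℚ +ℚ g (p * suc j))
    ≡⟨ cong (Σ< (suc j) (λ i → g (p * i)) +ℚ_) (ℚ.+-identityˡ _) ⟩
  Σ< (suc (suc j)) (λ i → g (p * i)) ∎
  where
  open ≡-Reasoning
  p = suc p′
  gaps≡0 : ∀ i → i < p′ → g (suc (p * j) + i) ≡ 0ℚ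
  gaps≡0 i i<p′ = g≡0 _ λ p∣ →
    ℕ.<⇒≱ (s≤s i<p′) (∣⇒≤ (∣m+n∣m⇒∣n (subst (p ∣_) (sym (ℕ.+-suc (p * j) i)) p∣) (m∣m*n j)))
  last≡ : suc (p * j) + p′ ≡ p * suc j
  last≡ = trans (sym (ℕ.+-suc (p * j) p′)) (trans (ℕ.+-comm (p * j) p) (sym (ℕ.*-suc p j)))

infix 4 _=O_

_=O_ : (ℕ → ℚ) → (ℕ → ℚ) → Set
f =O g = Σ ℚ λ K → 0ℚ ≤ℚ K × Σ ℕ λ N → ∀ n → N ≤ n → ∣ f n ∣ ≤ℚ K *ℚ g n

module _ {f g h : ℕ → ℚ} where

  =O-cong : (∀ n → f n ≡ h n) → f =O g → h =O g
  =O-cong f≡h (K , 0≤K , N , bound) =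
    K , 0≤K , N , λ n N≤n → subst (λ x → ∣ x ∣ ≤ℚ K *ℚ g n) (f≡h n) (bound n N≤n)

  =O-+ : f =O h → g =O h → (λ n → f n +ℚ g n) =O h
  =O-+ (K , 0≤K , M , f≤) (L , 0≤L , N , g≤) = K +ℚ L , +-nonneg 0≤K 0≤L , M ⊔ N , bound
    where
    bound : ∀ n → M ⊔ N ≤ n → ∣ f n +ℚ g n ∣ ≤ℚ (K +ℚ L) *ℚ h n
    bound n M⊔N≤n = begin
      ∣ f n +ℚ g n ∣       ≤⟨ ℚ.∣p+q∣≤∣p∣+∣q∣ (f n) (g n) ⟩
      ∣ f n ∣ +ℚ ∣ g n ∣   ≤⟨ ℚ.+-mono-≤ (f≤ n (ℕ.m⊔n≤o⇒m≤o M N M⊔N≤n))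
                                         (g≤ n (ℕ.m⊔n≤o⇒n≤o M N M⊔N≤n)) ⟩
      K *ℚ h n +ℚ L *ℚ h n ≡⟨ ℚ.*-distribʳ-+ (h n) K L ⟨
      (K +ℚ L) *ℚ h n      ∎
      where open ℚ.≤-Reasoning

  =O-trans : f =O g → g =O h → f =O h
  =O-trans (K , 0≤K , M , f≤) (L , 0≤L , N , g≤) = K *ℚ L , *-nonneg 0≤K 0≤L , M ⊔ N , bound
    where
    bound : ∀ n → M ⊔ N ≤ n → ∣ f n ∣ ≤ℚ (K *ℚ L) *ℚ h n
    bound n M⊔N≤n = begin
      ∣ f n ∣          ≤⟨ f≤ n (ℕ.m⊔n≤o⇒m≤o M N M⊔N≤n) ⟩
      K *ℚ g n         ≤⟨ *-monoˡ-≤-nonneg 0≤K (ℚ.≤-trans (p≤∣p∣ (g n)) (g≤ n (ℕ.m⊔n≤o⇒n≤o M N M⊔N≤n))) ⟩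
      K *ℚ (L *ℚ h n)  ≡⟨ ℚ.*-assoc K L (h n) ⟨
      (K *ℚ L) *ℚ h n  ∎
      where open ℚ.≤-Reasoning

module _ {f g : ℕ → ℚ} where

  =O-*ˡ : ∀ a → f =O g → (λ n → a *ℚ f n) =O g
  =O-*ˡ a (K , 0≤K , N , f≤) = ∣ a ∣ *ℚ K , *-nonneg (ℚ.0≤∣p∣ a) 0≤K , N , λ n N≤n → begin
    ∣ a *ℚ f n ∣          ≡⟨ ℚ.∣p*q∣≡∣p∣*∣q∣ a (f n) ⟩
    ∣ a ∣ *ℚ ∣ f n ∣      ≤⟨ *-monoˡ-≤-nonneg (ℚ.0≤∣p∣ a) (f≤ n N≤n) ⟩
    ∣ a ∣ *ℚ (K *ℚ g n)   ≡⟨ ℚ.*-assoc ∣ a ∣ K (g n) ⟨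
    (∣ a ∣ *ℚ K) *ℚ g n   ∎
    where open ℚ.≤-Reasoning

  =O-*ʳ : ∀ {w : ℕ → ℚ} → (∀ n → 0ℚ ≤ℚ w n) → f =O g → (λ n → f n *ℚ w n) =O (λ n → g n *ℚ w n)
  =O-*ʳ {w} 0≤w (K , 0≤K , N , f≤) = K , 0≤K , N , λ n N≤n → begin
    ∣ f n *ℚ w n ∣       ≡⟨ ℚ.∣p*q∣≡∣p∣*∣q∣ (f n) (w n) ⟩
    ∣ f n ∣ *ℚ ∣ w n ∣   ≡⟨ cong (∣ f n ∣ *ℚ_) (ℚ.0≤p⇒∣p∣≡p (0≤w n)) ⟩
    ∣ f n ∣ *ℚ w n       ≤⟨ *-monoʳ-≤-nonneg (0≤w n) (f≤ n N≤n) ⟩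
    (K *ℚ g n) *ℚ w n    ≡⟨ ℚ.*-assoc K (g n) (w n) ⟩
    K *ℚ (g n *ℚ w n)    ∎
    where open ℚ.≤-Reasoning

  nonneg-≤⇒=O : ∀ K → 0ℚ ≤ℚ K → (∀ n → 0ℚ ≤ℚ f n) → (∀ n → f n ≤ℚ K *ℚ g n) → f =O g
  nonneg-≤⇒=O K 0≤K 0≤f f≤ =
    K , 0≤K , 0 , λ n _ → subst (_≤ℚ K *ℚ g n) (sym (ℚ.0≤p⇒∣p∣≡p (0≤f n))) (f≤ n)

  =O-shift : ∀ m → f =O g → (λ n → f (m + n)) =O (λ n → g (m + n))
  =O-shift m (K , 0≤K , N , f≤) = K , 0≤K , N , λ n N≤n → f≤ (m + n) (ℕ.≤-trans N≤n (ℕ.m≤n+m n m))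

  =O-unshift : ∀ m → (λ n → f (m + n)) =O (λ n → g (m + n)) → f =O g
  =O-unshift m (K , 0≤K , N , f≤) = K , 0≤K , m + N , bound
    where
    bound : ∀ n → m + N ≤ n → ∣ f n ∣ ≤ℚ K *ℚ g n
    bound n m+N≤n = subst (λ k → ∣ f k ∣ ≤ℚ K *ℚ g k) (ℕ.m+[n∸m]≡n (ℕ.m+n≤o⇒m≤o m m+N≤n))
                      (f≤ (n ∸ m) (subst (_≤ n ∸ m) (ℕ.m+n∸m≡n m N) (ℕ.∸-monoˡ-≤ m m+N≤n)))

  =O-everywhere : (∀ n → 0ℚ <ℚ g n) → f =O g → Σ ℚ λ L → 0ℚ ≤ℚ L × ∀ n → ∣ f n ∣ ≤ℚ L *ℚ g n
  =O-everywhere 0<g (K , 0≤K , N , f≤) = extend N K 0≤K f≤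
    where
    extend : ∀ N K → 0ℚ ≤ℚ K → (∀ n → N ≤ n → ∣ f n ∣ ≤ℚ K *ℚ g n) →
             Σ ℚ λ L → 0ℚ ≤ℚ L × ∀ n → ∣ f n ∣ ≤ℚ L *ℚ g n
    extend zero    K 0≤K f≤ = K , 0≤K , λ n → f≤ n z≤n
    extend (suc N) K 0≤K f≤ = extend N (K +ℚ x) (+-nonneg 0≤K 0≤x) bound
      where
      x = ∣ f N ∣ *ℚ g N ⁻¹
      0≤x : 0ℚ ≤ℚ x
      0≤x = *-nonneg (ℚ.0≤∣p∣ (f N)) (⁻¹-nonneg (ℚ.<⇒≤ (0<g N)))
      gN≢0 : g N ≢ 0ℚ
      gN≢0 gN≡0 = ℚ.<-irrefl (sym gN≡0) (0<g N)
      fN≡ : ∣ f N ∣ ≡ x *ℚ g N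
      fN≡ = begin
        ∣ f N ∣                       ≡⟨ ℚ.*-identityʳ ∣ f N ∣ ⟨
        ∣ f N ∣ *ℚ 1ℚ                 ≡⟨ cong (∣ f N ∣ *ℚ_) (trans (ℚ.*-comm (g N ⁻¹) (g N)) (⁻¹-inverseʳ gN≢0)) ⟨
        ∣ f N ∣ *ℚ (g N ⁻¹ *ℚ g N)    ≡⟨ ℚ.*-assoc ∣ f N ∣ (g N ⁻¹) (g N) ⟨
        x *ℚ g N                      ∎
        where open ≡-Reasoning
      bound : ∀ n → N ≤ n → ∣ f n ∣ ≤ℚ (K +ℚ x) *ℚ g n
      bound n N≤n with n ℕ.≟ N
      ... | yes refl = ℚ.≤-trans (ℚ.≤-reflexive fN≡)
                         (*-monoʳ-≤-nonneg (ℚ.<⇒≤ (0<g N)) (subst (_≤ℚ K +ℚ x) (ℚ.+-identityˡ x) (ℚ.+-monoˡ-≤ x 0≤K)))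
      ... | no  n≢N  = ℚ.≤-trans (f≤ n (ℕ.≤∧≢⇒< N≤n (λ N≡n → n≢N (sym N≡n))))
                         (*-monoʳ-≤-nonneg (ℚ.<⇒≤ (0<g n)) (≤-+-nonnegʳ {K} 0≤x))

-- Convolution powers

convPow : (ℕ → ℚ) → ℕ → ℕ → ℚ
convPow β zero    zero    = 1ℚ
convPow β zero    (suc j) = 0ℚ
convPow β (suc m) j       = Σ< (suc j) (λ i → β i *ℚ convPow β m (j ∸ i))

convPow-nonneg : ∀ {β} → (∀ i → 0ℚ ≤ℚ β i) → ∀ m j → 0ℚ ≤ℚ convPow β m j
convPow-nonneg 0≤β zero    zero    = ℚ.<⇒≤ (ℚ.positive⁻¹ 1ℚ)
convPow-nonneg 0≤β zero    (suc j) = ℚ.≤-refl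
convPow-nonneg 0≤β (suc m) j       = Σ<-nonneg (suc j) λ i _ → *-nonneg (0≤β i) (convPow-nonneg 0≤β m (j ∸ i))

module ConvolutionPowers (β : ℕ → ℚ) (β₀≡0 : β 0 ≡ 0ℚ) where

  β₀*≡0 : ∀ x → β 0 *ℚ x ≡ 0ℚ
  β₀*≡0 x = trans (cong (_*ℚ x) β₀≡0) (ℚ.*-zeroˡ x)

  convPow-vanishes : ∀ m j → j < m → convPow β m j ≡ 0ℚ
  convPow-vanishes (suc m) j j<1+m = Σ<-zero (suc j) term≡0
    where
    term≡0 : ∀ i → i < suc j → β i *ℚ convPow β m (j ∸ i) ≡ 0ℚ
    term≡0 zero    _       = β₀*≡0 _
    term≡0 (suc i) 1+i≤j   = trans (cong (β (suc i) *ℚ_) (convPow-vanishes m (j ∸ suc i) j-1-i<m)) (ℚ.*-zeroʳ (β (suc i)))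
      where
      j-1-i<m : j ∸ suc i < m
      j-1-i<m = ℕ.<-≤-trans (ℕ.∸-monoʳ-< (s≤s z≤n) (ℕ.≤-pred 1+i≤j)) (ℕ.≤-pred j<1+m)

  convPow-one : ∀ j → convPow β 1 j ≡ β j
  convPow-one j = begin
    Σ< j F +ℚ F j   ≡⟨ cong₂ _+ℚ_ (Σ<-zero j early≡0) last≡ ⟩
    0ℚ +ℚ β j       ≡⟨ ℚ.+-identityˡ (β j) ⟩
    β j             ∎
    where
    open ≡-Reasoning
    F = λ i → β i *ℚ convPow β 0 (j ∸ i)
    early≡0 : ∀ i → i < j → F i ≡ 0ℚ
    early≡0 i i<j = trans (cong (λ k → β i *ℚ convPow β 0 k) (ℕ.+-∸-assoc 1 i<j)) (ℚ.*-zeroʳ (β i))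
    last≡ : F j ≡ β j
    last≡ = trans (cong (λ k → β j *ℚ convPow β 0 k) (ℕ.n∸n≡0 j)) (ℚ.*-identityʳ (β j))

  convPow-diagonal : ∀ m → convPow β m m ≡ β 1 ^ℚ m
  convPow-diagonal zero    = refl
  convPow-diagonal (suc m) = begin
    Σ< (suc (suc m)) F                    ≡⟨ Σ<-head (suc m) F ⟩
    F 0 +ℚ Σ< (suc m) F′                  ≡⟨ cong₂ _+ℚ_ (β₀*≡0 _) (Σ<-head m F′) ⟩
    0ℚ +ℚ (F 1 +ℚ Σ< m (λ i → F (2 + i)))  ≡⟨ cong (λ x → 0ℚ +ℚ (F 1 +ℚ x)) high≡0 ⟩
    0ℚ +ℚ (F 1 +ℚ 0ℚ)                     ≡⟨ trans (ℚ.+-identityˡ _) (ℚ.+-identityʳ _) ⟩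
    β 1 *ℚ convPow β m m                  ≡⟨ cong (β 1 *ℚ_) (convPow-diagonal m) ⟩
    β 1 ^ℚ suc m                          ∎
    where
    open ≡-Reasoning
    F = λ i → β i *ℚ convPow β m (suc m ∸ i)
    F′ = λ i → F (suc i)
    high≡0 : Σ< m (λ i → F (2 + i)) ≡ 0ℚ
    high≡0 = Σ<-zero m λ i i<m →
      trans (cong (β (2 + i) *ℚ_) (convPow-vanishes m (m ∸ suc i) (ℕ.∸-monoʳ-< (s≤s z≤n) i<m))) (ℚ.*-zeroʳ (β (2 + i)))

  convPow-split : ∀ m u →
    convPow β (suc m) (suc m + suc u) ≡
    β 1 *ℚ convPow β m (m + suc u)
      +ℚ Σ< u (λ i → β (2 + i) *ℚ convPow β m (m + (u ∸ i)))
      +ℚ β (2 + u) *ℚ β 1 ^ℚ m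
  convPow-split m u = begin
    Σ< (suc n) F
      ≡⟨ cong (λ l → Σ< l F) length≡ ⟩
    Σ< (2 + (u + suc m)) F
      ≡⟨ Σ<-+ 2 (u + suc m) F ⟩
    Σ< 2 F +ℚ Σ< (u + suc m) (λ i → F (2 + i))
      ≡⟨ cong (Σ< 2 F +ℚ_) (Σ<-+ u (suc m) (λ i → F (2 + i))) ⟩
    Σ< 2 F +ℚ (Σ< u (λ i → F (2 + i)) +ℚ Σ< (suc m) (λ i → F (2 + (u + i))))
      ≡⟨ cong (λ x → Σ< 2 F +ℚ (Σ< u (λ i → F (2 + i)) +ℚ x)) (Σ<-head m (λ i → F (2 + (u + i)))) ⟩
    (0ℚ +ℚ F 0) +ℚ F 1
      +ℚ (Σ< u (λ i → F (2 + i)) +ℚ (F (2 + (u + 0)) +ℚ Σ< m (λ i → F (2 + (u + suc i)))))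
      ≡⟨ cong₂ (λ x y → (0ℚ +ℚ x) +ℚ F 1 +ℚ y) (β₀*≡0 _) (cong₂ _+ℚ_ middle≡ (cong₂ _+ℚ_ last≡ tail≡0)) ⟩
    (0ℚ +ℚ 0ℚ) +ℚ F 1 +ℚ (Mid +ℚ (β (2 + u) *ℚ β 1 ^ℚ m +ℚ 0ℚ))
      ≡⟨ regroup (F 1) Mid (β (2 + u) *ℚ β 1 ^ℚ m) ⟩
    F 1 +ℚ Mid +ℚ β (2 + u) *ℚ β 1 ^ℚ m
      ∎
    where
    open ≡-Reasoning
    n = suc m + suc u
    F = λ i → β i *ℚ convPow β m (n ∸ i)
    Mid = Σ< u (λ i → β (2 + i) *ℚ convPow β m (m + (u ∸ i)))
    length≡ : suc n ≡ 2 + (u + suc m)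
    length≡ = cong (λ k → 2 + k) (trans (ℕ.+-comm m (suc u)) (sym (ℕ.+-suc u m)))
    n-2-i≡ : ∀ {i} → i ≤ u → n ∸ (2 + i) ≡ m + (u ∸ i)
    n-2-i≡ {i} i≤u = trans (cong (_∸ suc i) (ℕ.+-suc m u)) (ℕ.+-∸-assoc m i≤u)
    middle≡ : Σ< u (λ i → F (2 + i)) ≡ Mid
    middle≡ = Σ<-cong u λ i i<u → cong (λ k → β (2 + i) *ℚ convPow β m k) (n-2-i≡ (ℕ.<⇒≤ i<u))
    last≡ : F (2 + (u + 0)) ≡ β (2 + u) *ℚ β 1 ^ℚ m
    last≡ rewrite ℕ.+-identityʳ u = cong (β (2 + u) *ℚ_) (trans (cong (convPow β m) n-2-u≡m) (convPow-diagonal m))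
      where
      n-2-u≡m : n ∸ (2 + u) ≡ m
      n-2-u≡m = trans (n-2-i≡ ℕ.≤-refl) (trans (cong (m +_) (ℕ.n∸n≡0 u)) (ℕ.+-identityʳ m))
    tail≡0 : Σ< m (λ i → F (2 + (u + suc i))) ≡ 0ℚ
    tail≡0 = Σ<-zero m λ i i<m →
      trans (cong (β (2 + (u + suc i)) *ℚ_) (convPow-vanishes m _ (too-far i<m))) (ℚ.*-zeroʳ (β (2 + (u + suc i))))
      where
      too-far : ∀ {i} → i < m → n ∸ (2 + (u + suc i)) < m
      too-far {i} i<m = subst (_< m) (sym n-2-u-1-i≡) (ℕ.∸-monoʳ-< (s≤s z≤n) i<m)
        where
        n-2-u-1-i≡ : n ∸ (2 + (u + suc i)) ≡ m ∸ suc i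
        n-2-u-1-i≡ = trans (sym (ℕ.∸-+-assoc (m + suc u) (suc u) (suc i)))
                           (cong (_∸ suc i) (ℕ.m+n∸n≡m m (suc u)))
    regroup : ∀ a b c → (0ℚ +ℚ 0ℚ) +ℚ a +ℚ (b +ℚ (c +ℚ 0ℚ)) ≡ a +ℚ b +ℚ c
    regroup = solve 3 (λ a b c → (con 0ℚ :+ con 0ℚ) :+ a :+ (b :+ (c :+ con 0ℚ)) := a :+ b :+ c) refl

-- The second half of Gargantuan.
GargantuanSums : (ℕ → ℚ) → Set
GargantuanSums s = ∀ r → r ≥ 1 → Σ ℚ λ K → Σ ℕ λ N → ∀ n → n ≥ N →
  sumℚFromTo r (n ∸ r) (λ k → ∣ s k *ℚ s (n ∸ k) ∣) ≤ℚ K *ℚ ∣ s (n ∸ r) ∣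

-- s is the ordinary sequence construction 1/(1 - β): s 0 = 1 and s = β * s in positive degrees.
module ConvolutionAsymptotics
  (β s : ℕ → ℚ) (β₀≡0 : β 0 ≡ 0ℚ) (0≤β : ∀ i → 0ℚ ≤ℚ β i)
  (s₀≡1 : s 0 ≡ 1ℚ) (0≤s : ∀ j → 0ℚ ≤ℚ s j) (0<s₁ : 0ℚ <ℚ s 1)
  (s-rec : ∀ j → s (suc j) ≡ Σ< (suc (suc j)) (λ i → β i *ℚ s (suc j ∸ i)))
  (s-gargantuan : GargantuanSums s)
  where

  open ConvolutionPowers β β₀≡0

  interior : ℕ → ℚ
  interior j = Σ< j (λ i → β (suc i) *ℚ s (j ∸ i))

  0≤interior : ∀ j → 0ℚ ≤ℚ interior j
  0≤interior j = Σ<-nonneg j λ i _ → *-nonneg (0≤β (suc i)) (0≤s (j ∸ i))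

  s-suc≡β+interior : ∀ j → s (suc j) ≡ β (suc j) +ℚ interior j
  s-suc≡β+interior j = begin
    s (suc j)                                        ≡⟨ s-rec j ⟩
    Σ< (suc (suc j)) F                               ≡⟨ Σ<-head (suc j) F ⟩
    F 0 +ℚ (interior j +ℚ F (suc j))                 ≡⟨ cong₂ (λ x y → x +ℚ (interior j +ℚ y)) (β₀*≡0 _) last≡ ⟩
    0ℚ +ℚ (interior j +ℚ β (suc j))                  ≡⟨ trans (ℚ.+-identityˡ _) (ℚ.+-comm (interior j) (β (suc j))) ⟩
    β (suc j) +ℚ interior j                          ∎
    where
    open ≡-Reasoning
    F = λ i → β i *ℚ s (suc j ∸ i)
    last≡ : F (suc j) ≡ β (suc j)
    last≡ = trans (cong (λ k → β (suc j) *ℚ s k) (ℕ.n∸n≡0 j)) (trans (cong (β (suc j) *ℚ_) s₀≡1) (ℚ.*-identityʳ _))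

  c : ℚ
  c = β 1

  s₁≡c : s 1 ≡ c
  s₁≡c = trans (s-suc≡β+interior 0) (ℚ.+-identityʳ c)

  0<c : 0ℚ <ℚ c
  0<c = subst (0ℚ <ℚ_) s₁≡c 0<s₁

  β≤s : ∀ j → β j ≤ℚ s j
  β≤s zero    = subst (_≤ℚ s 0) (sym β₀≡0) (0≤s 0)
  β≤s (suc j) = subst (β (suc j) ≤ℚ_) (sym (s-suc≡β+interior j)) (≤-+-nonnegʳ (0≤interior j))

  c*s≤s-suc : ∀ j → c *ℚ s j ≤ℚ s (suc j)
  c*s≤s-suc j = subst (c *ℚ s j ≤ℚ_) (sym (s-rec j))
                  (term≤Σ< (suc (suc j)) (λ i _ → *-nonneg (0≤β i) (0≤s (suc j ∸ i))) (s≤s (s≤s z≤n)))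

  0<s : ∀ j → 0ℚ <ℚ s j
  0<s zero    = subst (0ℚ <ℚ_) (sym s₀≡1) (ℚ.positive⁻¹ 1ℚ)
  0<s (suc j) = ℚ.<-≤-trans (*-pos 0<c (0<s j)) (c*s≤s-suc j)

  s=Os-suc : s =O (λ j → s (suc j))
  s=Os-suc = nonneg-≤⇒=O (c ⁻¹) (⁻¹-nonneg (ℚ.<⇒≤ 0<c)) 0≤s λ j → begin
    s j                  ≡⟨ ℚ.*-identityˡ (s j) ⟨
    1ℚ *ℚ s j            ≡⟨ cong (_*ℚ s j) (trans (ℚ.*-comm (c ⁻¹) c) (⁻¹-inverseʳ c≢0)) ⟨
    (c ⁻¹ *ℚ c) *ℚ s j   ≡⟨ ℚ.*-assoc (c ⁻¹) c (s j) ⟩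
    c ⁻¹ *ℚ (c *ℚ s j)   ≤⟨ *-monoˡ-≤-nonneg (⁻¹-nonneg (ℚ.<⇒≤ 0<c)) (c*s≤s-suc j) ⟩
    c ⁻¹ *ℚ s (suc j)    ∎
    where
    open ℚ.≤-Reasoning
    c≢0 : c ≢ 0ℚ
    c≢0 c≡0 = ℚ.<-irrefl (sym c≡0) 0<c

  gargantuan-convolution=O : ∀ q → (λ u → Σ< u (λ i → s (suc q + i) *ℚ s (q + u ∸ i))) =O (λ u → s (q + u))
  gargantuan-convolution=O q with s-gargantuan (suc q) (s≤s z≤n)
  ... | K , N , sum≤ = ∣ K ∣ , ℚ.0≤∣p∣ K , suc N , bound
    where
    bound : ∀ u → suc N ≤ u → ∣ Σ< u (λ i → s (suc q + i) *ℚ s (q + u ∸ i)) ∣ ≤ℚ ∣ K ∣ *ℚ s (q + u)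
    bound (suc w) (s≤s N≤w) = begin
      ∣ Σ< (suc w) T ∣                   ≡⟨ ℚ.0≤p⇒∣p∣≡p (Σ<-nonneg (suc w) λ i _ → *-nonneg (0≤s _) (0≤s _)) ⟩
      Σ< (suc w) T                       ≡⟨ Σ<≡sum ⟩
      sumℚFromTo (suc q) (n ∸ suc q) f   ≤⟨ sum≤ n N≤n ⟩
      K *ℚ ∣ s (n ∸ suc q) ∣             ≤⟨ *-monoʳ-≤-nonneg (ℚ.0≤∣p∣ _) (p≤∣p∣ K) ⟩
      ∣ K ∣ *ℚ ∣ s (n ∸ suc q) ∣         ≡⟨ cong (∣ K ∣ *ℚ_) (trans (ℚ.0≤p⇒∣p∣≡p (0≤s _)) (cong s n∸q≡)) ⟩
      ∣ K ∣ *ℚ s (q + suc w)             ∎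
      where
      open ℚ.≤-Reasoning
      T = λ i → s (suc q + i) *ℚ s (q + suc w ∸ i)
      n = suc q + (q + suc w)
      f = λ k → ∣ s k *ℚ s (n ∸ k) ∣
      N≤n : N ≤ n
      N≤n = ℕ.≤-trans N≤w (ℕ.≤-trans (ℕ.m≤n+m w q)
                              (ℕ.≤-trans (ℕ.+-monoʳ-≤ q (ℕ.n≤1+n w)) (ℕ.m≤n+m _ (suc q))))
      n∸q≡ : n ∸ suc q ≡ q + suc w
      n∸q≡ = ℕ.m+n∸m≡n (suc q) (q + suc w)
      width≡ : q + suc w ∸ suc q ≡ w
      width≡ = trans (cong (_∸ suc q) (ℕ.+-suc q w)) (ℕ.m+n∸m≡n q w)
      q<q+1+w : suc q ≤ q + suc w
      q<q+1+w = subst (suc q ≤_) (sym (ℕ.+-suc q w)) (s≤s (ℕ.m≤m+n q w))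
      Σ<≡sum : Σ< (suc w) T ≡ sumℚFromTo (suc q) (n ∸ suc q) f
      Σ<≡sum = sym (begin-equality
        sumℚFromTo (suc q) (n ∸ suc q) f                      ≡⟨ cong (λ b → sumℚFromTo (suc q) b f) n∸q≡ ⟩
        sumℚFromTo (suc q) (q + suc w) f                      ≡⟨ sumℚFromTo≡Σ< (suc q) (q + suc w) f q<q+1+w ⟩
        Σ< (suc (q + suc w ∸ suc q)) (λ i → f (suc q + i))    ≡⟨ cong (λ l → Σ< (suc l) (λ i → f (suc q + i))) width≡ ⟩
        Σ< (suc w) (λ i → f (suc q + i))                      ≡⟨ Σ<-cong (suc w) (λ i _ → term≡ i) ⟩
        Σ< (suc w) T                                          ∎)
        where
        term≡ : ∀ i → f (suc q + i) ≡ T i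
        term≡ i = trans (ℚ.0≤p⇒∣p∣≡p (*-nonneg (0≤s _) (0≤s _)))
                        (cong (λ k → s (suc q + i) *ℚ s k) (ℕ.[m+n]∸[m+o]≡n∸o (suc q) (q + suc w) i))

  interior=Os : interior =O s
  interior=Os = =O-trans interior≤ (gargantuan-convolution=O 0)
    where
    interior≤ : interior =O (λ j → Σ< j (λ i → s (suc i) *ℚ s (j ∸ i)))
    interior≤ = nonneg-≤⇒=O 1ℚ (ℚ.<⇒≤ (ℚ.positive⁻¹ 1ℚ)) 0≤interior λ j →
      subst (interior j ≤ℚ_) (sym (ℚ.*-identityˡ _))
        (Σ<-mono-≤ j λ i _ → *-monoʳ-≤-nonneg (0≤s (j ∸ i)) (β≤s (suc i)))

  mainTerm : ℕ → ℕ → ℚ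
  mainTerm k t = ℕ→ℚ (suc k) *ℚ c ^ℚ k *ℚ s (suc t)

  error : ℕ → ℕ → ℚ
  error k t = convPow β (suc k) (suc k + t) -ℚ mainTerm k t

  middle : ℕ → ℕ → ℚ
  middle k u = Σ< u (λ i → β (2 + i) *ℚ convPow β (suc k) (suc k + (u ∸ i)))

  error-zero : ∀ t → error 0 t ≡ - 1ℚ *ℚ interior t
  error-zero t rewrite convPow-one (suc t) | s-suc≡β+interior t =
    solve 2 (λ b i → b :- con 1ℚ :* con 1ℚ :* (b :+ i) := :- con 1ℚ :* i) refl (β (suc t)) (interior t)

  mainTerm-suc : ∀ k t → mainTerm (suc k) t ≡ c *ℚ mainTerm k t +ℚ c ^ℚ suc k *ℚ s (suc t)
  mainTerm-suc k t = begin
    ℕ→ℚ (suc (suc k)) *ℚ (c *ℚ cᵏ) *ℚ x   ≡⟨ cong (λ a → a *ℚ (c *ℚ cᵏ) *ℚ x) (ℕ→ℚ-suc (suc k)) ⟩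
    (1ℚ +ℚ n) *ℚ (c *ℚ cᵏ) *ℚ x            ≡⟨ distribute n c cᵏ x ⟩
    c *ℚ (n *ℚ cᵏ *ℚ x) +ℚ c *ℚ cᵏ *ℚ x    ∎
    where
    open ≡-Reasoning
    n = ℕ→ℚ (suc k)
    cᵏ = c ^ℚ k
    x = s (suc t)
    distribute : ∀ n c cᵏ x → (1ℚ +ℚ n) *ℚ (c *ℚ cᵏ) *ℚ x ≡ c *ℚ (n *ℚ cᵏ *ℚ x) +ℚ c *ℚ cᵏ *ℚ x
    distribute = solve 4 (λ n c cᵏ x → (con 1ℚ :+ n) :* (c :* cᵏ) :* x := c :* (n :* cᵏ :* x) :+ c :* cᵏ :* x) refl

  error-suc : ∀ k u → error (suc k) (suc u) ≡
              c *ℚ error k (suc u) +ℚ middle k u +ℚ (- (c ^ℚ suc k)) *ℚ interior (suc u)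
  error-suc k u = begin
    convPow β (2 + k) (2 + k + suc u) -ℚ mainTerm (suc k) (suc u)
      ≡⟨ cong₂ _-ℚ_ (convPow-split (suc k) u)
                    (trans (mainTerm-suc k (suc u)) (cong (λ x → c *ℚ M +ℚ cᵏ⁺¹ *ℚ x) (s-suc≡β+interior (suc u)))) ⟩
    c *ℚ π +ℚ middle k u +ℚ β (2 + u) *ℚ cᵏ⁺¹ -ℚ (c *ℚ M +ℚ cᵏ⁺¹ *ℚ (β (2 + u) +ℚ interior (suc u)))
      ≡⟨ solve 7 (λ c π M mid b i cᵏ⁺¹ → c :* π :+ mid :+ b :* cᵏ⁺¹ :- (c :* M :+ cᵏ⁺¹ :* (b :+ i))
                                      := c :* (π :- M) :+ mid :+ (:- cᵏ⁺¹) :* i)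
               refl c π M (middle k u) (β (2 + u)) (interior (suc u)) cᵏ⁺¹ ⟩
    c *ℚ (π -ℚ M) +ℚ middle k u +ℚ (- cᵏ⁺¹) *ℚ interior (suc u)
      ∎
    where
    open ≡-Reasoning
    π = convPow β (suc k) (suc k + suc u)
    M = mainTerm k (suc u)
    cᵏ⁺¹ = c ^ℚ suc k

  0≤cᵏ : ∀ k → 0ℚ ≤ℚ c ^ℚ k
  0≤cᵏ zero    = ℚ.<⇒≤ (ℚ.positive⁻¹ 1ℚ)
  0≤cᵏ (suc k) = *-nonneg (ℚ.<⇒≤ 0<c) (0≤cᵏ k)

  mainTerm=O : ∀ k → mainTerm k =O (λ t → s (suc t))
  mainTerm=O k = nonneg-≤⇒=O _ 0≤coefficient (λ t → *-nonneg 0≤coefficient (0≤s (suc t))) (λ t → ℚ.≤-refl)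
    where
    0≤coefficient : 0ℚ ≤ℚ ℕ→ℚ (suc k) *ℚ c ^ℚ k
    0≤coefficient = *-nonneg (ℕ→ℚ-nonneg (suc k)) (0≤cᵏ k)

  mainTerm+error≡convPow : ∀ k t → mainTerm k t +ℚ error k t ≡ convPow β (suc k) (suc k + t)
  mainTerm+error≡convPow k t = solve 2 (λ m e → m :+ (e :- m) := e) refl (mainTerm k t) (convPow β (suc k) (suc k + t))

  module _ (k : ℕ) (error-k=Os : error k =O s) where

    convPow=O : (λ t → convPow β (suc k) (suc k + t)) =O (λ t → s (suc t))
    convPow=O = =O-cong (mainTerm+error≡convPow k) (=O-+ (mainTerm=O k) (=O-trans error-k=Os s=Os-suc))

    convPow≤s-suc : Σ ℚ λ L → 0ℚ ≤ℚ L × ∀ t → convPow β (suc k) (suc k + t) ≤ℚ L *ℚ s (suc t)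
    convPow≤s-suc = bounded (=O-everywhere (λ t → 0<s (suc t)) convPow=O)
      where
      bounded : (Σ ℚ λ L → 0ℚ ≤ℚ L × ∀ t → ∣ convPow β (suc k) (suc k + t) ∣ ≤ℚ L *ℚ s (suc t)) →
                Σ ℚ λ L → 0ℚ ≤ℚ L × ∀ t → convPow β (suc k) (suc k + t) ≤ℚ L *ℚ s (suc t)
      bounded (L , 0≤L , bound) = L , 0≤L , λ t → ℚ.≤-trans (p≤∣p∣ _) (bound t)

    middle=O : middle k =O (λ u → s (suc u))
    middle=O = from-bound convPow≤s-suc
      where
      from-bound : (Σ ℚ λ L → 0ℚ ≤ℚ L × ∀ t → convPow β (suc k) (suc k + t) ≤ℚ L *ℚ s (suc t)) →
                   middle k =O (λ u → s (suc u))
      from-bound (L , 0≤L , convPow≤) = =O-trans middle≤ (gargantuan-convolution=O 1)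
        where
        0≤term : ∀ u i → 0ℚ ≤ℚ β (2 + i) *ℚ convPow β (suc k) (suc k + (u ∸ i))
        0≤term u i = *-nonneg (0≤β (2 + i)) (convPow-nonneg 0≤β (suc k) (suc k + (u ∸ i)))
        term≤ : ∀ u i → i < u →
                β (2 + i) *ℚ convPow β (suc k) (suc k + (u ∸ i)) ≤ℚ L *ℚ (s (2 + i) *ℚ s (suc u ∸ i))
        term≤ u i i<u = begin
          β (2 + i) *ℚ convPow β (suc k) (suc k + (u ∸ i))
            ≤⟨ *-mono-≤-nonneg (0≤β (2 + i)) (convPow-nonneg 0≤β (suc k) (suc k + (u ∸ i)))
                               (β≤s (2 + i)) (convPow≤ (u ∸ i)) ⟩
          s (2 + i) *ℚ (L *ℚ s (suc (u ∸ i)))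
            ≡⟨ cong (λ j → s (2 + i) *ℚ (L *ℚ s j)) (ℕ.+-∸-assoc 1 (ℕ.<⇒≤ i<u)) ⟨
          s (2 + i) *ℚ (L *ℚ s (suc u ∸ i))
            ≡⟨ solve 3 (λ a l b → a :* (l :* b) := l :* (a :* b)) refl (s (2 + i)) L (s (suc u ∸ i)) ⟩
          L *ℚ (s (2 + i) *ℚ s (suc u ∸ i))
            ∎
          where open ℚ.≤-Reasoning
        middle≤ : middle k =O (λ u → Σ< u (λ i → s (2 + i) *ℚ s (suc u ∸ i)))
        middle≤ = nonneg-≤⇒=O L 0≤L (λ u → Σ<-nonneg u λ i _ → 0≤term u i) λ u →
          subst (middle k u ≤ℚ_) (sym (*-distribˡ-Σ< u L _)) (Σ<-mono-≤ u (term≤ u))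

  error=Os : ∀ k → error k =O s
  error=Os zero    = =O-cong (λ t → sym (error-zero t)) (=O-*ˡ (- 1ℚ) interior=Os)
  error=Os (suc k) = =O-unshift 1 (=O-cong (λ u → sym (error-suc k u))
    (=O-+ (=O-+ (=O-*ˡ c (=O-shift 1 (error=Os k))) (middle=O k (error=Os k)))
          (=O-*ˡ (- (c ^ℚ suc k)) (=O-shift 1 interior=Os))))

-- Labelled products

labelledProduct : (ℕ → ℕ) → (ℕ → ℕ) → ℕ → ℕ
labelledProduct f g n = sumTo n (λ k → (n C k) * f k * g (n ∸ k))

sumTo-≥-term : ∀ n f {k} → k ≤ n → f k ≤ sumTo n f
sumTo-≥-term zero    f {zero} _ = ℕ.≤-refl
sumTo-≥-term (suc n) f {k} k≤1+n with k ℕ.≟ suc n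
... | yes refl = ℕ.m≤n+m (f (suc n)) (sumTo n f)
... | no  k≢   = ℕ.≤-trans (sumTo-≥-term n f (ℕ.≤-pred (ℕ.≤∧≢⇒< k≤1+n k≢))) (ℕ.m≤m+n (sumTo n f) (f (suc n)))

sumTo-zero : ∀ n f → (∀ k → k ≤ n → f k ≡ 0) → sumTo n f ≡ 0
sumTo-zero zero    f f≡0 = f≡0 0 z≤n
sumTo-zero (suc n) f f≡0 = cong₂ _+_ (sumTo-zero n f (λ k k≤n → f≡0 k (ℕ.m≤n⇒m≤1+n k≤n))) (f≡0 (suc n) ℕ.≤-refl)

module _ {b : ℕ → ℕ} (b₀≡0 : b 0 ≡ 0) where

  powCount-vanishes : ∀ m j → j < m → powCount b m j ≡ 0
  powCount-vanishes (suc m) j j<1+m = sumTo-zero j _ term≡0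
    where
    term≡0 : ∀ i → i ≤ j → (j C i) * b i * powCount b m (j ∸ i) ≡ 0
    term≡0 zero    _     rewrite b₀≡0 | ℕ.*-zeroʳ (j C 0) = refl
    term≡0 (suc i) 1+i≤j = trans (cong ((j C suc i) * b (suc i) *_) (powCount-vanishes m (j ∸ suc i) j-1-i<m))
                                 (ℕ.*-zeroʳ ((j C suc i) * b (suc i)))
      where
      j-1-i<m : j ∸ suc i < m
      j-1-i<m = ℕ.<-≤-trans (ℕ.∸-monoʳ-< (s≤s z≤n) 1+i≤j) (ℕ.≤-pred j<1+m)

  count≤seqCount : ∀ k → b k ≤ seqCount b k
  count≤seqCount zero    = subst (_≤ seqCount b 0) (sym b₀≡0) z≤n
  count≤seqCount (suc k) = ℕ.≤-trans b≤powCount₁ (sumTo-≥-term (suc k) (λ m → powCount b m (suc k)) (s≤s z≤n))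
    where
    last≡ : (suc k C suc k) * b (suc k) * powCount b 0 (k ∸ k) ≡ b (suc k)
    last≡ rewrite nCn≡1 (suc k) | ℕ.n∸n≡0 k = trans (ℕ.*-identityʳ _) (ℕ.+-identityʳ _)
    b≤powCount₁ : b (suc k) ≤ powCount b 1 (suc k)
    b≤powCount₁ = subst (_≤ powCount b 1 (suc k)) last≡ (sumTo-≥-term (suc k) _ ℕ.≤-refl)

  Σ<-powCount≡seqCount : ∀ {N r} → r < N → Σ< N (λ m → ℕ→ℚ (powCount b m r)) ≡ ℕ→ℚ (seqCount b r)
  Σ<-powCount≡seqCount {N} {r} r<N = begin
    Σ< N P                                                   ≡⟨ cong (λ l → Σ< l P) (ℕ.m+[n∸m]≡n r<N) ⟨
    Σ< (suc r + (N ∸ suc r)) P                               ≡⟨ Σ<-+ (suc r) (N ∸ suc r) P ⟩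
    Σ< (suc r) P +ℚ Σ< (N ∸ suc r) (λ i → P (suc r + i))     ≡⟨ cong (Σ< (suc r) P +ℚ_) (Σ<-zero (N ∸ suc r) too-many≡0) ⟩
    Σ< (suc r) P +ℚ 0ℚ                                       ≡⟨ ℚ.+-identityʳ _ ⟩
    Σ< (suc r) P                                             ≡⟨ ℕ→ℚ-sumTo r (λ m → powCount b m r) ⟨
    ℕ→ℚ (seqCount b r)                                       ∎
    where
    open ≡-Reasoning
    P = λ m → ℕ→ℚ (powCount b m r)
    too-many≡0 : ∀ i → i < N ∸ suc r → P (suc r + i) ≡ 0ℚ
    too-many≡0 i _ = cong ℕ→ℚ (powCount-vanishes (suc r + i) r (s≤s (ℕ.m≤m+n r i)))

  seqCount≡labelledProduct : ∀ {N} → 0 < N → seqCount b N ≡ labelledProduct b (seqCount b) N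
  seqCount≡labelledProduct {suc n} _ = ℕ→ℚ-injective (begin
    ℕ→ℚ (seqCount b N)                                          ≡⟨ ℕ→ℚ-sumTo N (λ m → powCount b m N) ⟩
    Σ< (suc N) (λ m → P m N)                                    ≡⟨ trans (Σ<-head N (λ m → P m N)) (ℚ.+-identityˡ _) ⟩
    Σ< N (λ m → P (suc m) N)                                    ≡⟨ Σ<-cong N (λ m _ → unfold m) ⟩
    Σ< N (λ m → Σ< (suc N) (λ k → T k *ℚ P m (N ∸ k)))          ≡⟨ Σ<-swap N (suc N) (λ m k → T k *ℚ P m (N ∸ k)) ⟩
    Σ< (suc N) (λ k → Σ< N (λ m → T k *ℚ P m (N ∸ k)))          ≡⟨ Σ<-cong (suc N) (λ k _ → *-distribˡ-Σ< N (T k) _) ⟨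
    Σ< (suc N) (λ k → T k *ℚ Σ< N (λ m → P m (N ∸ k)))          ≡⟨ Σ<-cong (suc N) (λ k _ → inner≡ k) ⟩
    Σ< (suc N) (λ k → T k *ℚ ℕ→ℚ (seqCount b (N ∸ k)))          ≡⟨ Σ<-cong (suc N) (λ k _ → split k) ⟨
    Σ< (suc N) (λ k → ℕ→ℚ ((N C k) * b k * seqCount b (N ∸ k)))  ≡⟨ ℕ→ℚ-sumTo N _ ⟨
    ℕ→ℚ (sumTo N (λ k → (N C k) * b k * seqCount b (N ∸ k)))    ∎)
    where
    open ≡-Reasoning
    N = suc n
    P = λ m r → ℕ→ℚ (powCount b m r)
    T = λ k → ℕ→ℚ ((N C k) * b k)
    unfold : ∀ m → P (suc m) N ≡ Σ< (suc N) (λ k → T k *ℚ P m (N ∸ k))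
    unfold m = trans (ℕ→ℚ-sumTo N _) (Σ<-cong (suc N) (λ k _ → ℕ→ℚ-homo-* ((N C k) * b k) _))
    split : ∀ k → ℕ→ℚ ((N C k) * b k * seqCount b (N ∸ k)) ≡ T k *ℚ ℕ→ℚ (seqCount b (N ∸ k))
    split k = ℕ→ℚ-homo-* ((N C k) * b k) (seqCount b (N ∸ k))
    T₀*≡0 : ∀ x → T 0 *ℚ x ≡ 0ℚ
    T₀*≡0 x = trans (cong (λ t → ℕ→ℚ t *ℚ x) (trans (cong ((N C 0) *_) b₀≡0) (ℕ.*-zeroʳ (N C 0)))) (ℚ.*-zeroˡ x)
    inner≡ : ∀ k → T k *ℚ Σ< N (λ m → P m (N ∸ k)) ≡ T k *ℚ ℕ→ℚ (seqCount b (N ∸ k))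
    inner≡ zero    = trans (T₀*≡0 _) (sym (T₀*≡0 _))
    inner≡ (suc k) = cong (T (suc k) *ℚ_) (Σ<-powCount≡seqCount (s≤s (ℕ.m∸n≤m n k)))

binomial*factorials≡factorial : ∀ {n k} → k ≤ n → (n C k) * (k ! * (n ∸ k) !) ≡ n !
binomial*factorials≡factorial {n} {k} k≤n rewrite nCk≡n!/k![n-k]! k≤n =
  m/n*n≡m {{ℕ._!*_!≢0 k (n ∸ k)}} (k![n∸k]!∣n! k≤n)

binomial÷factorial : ∀ {n k} → k ≤ n → ℕ→ℚ (n C k) *ℚ ℕ→ℚ (n !) ⁻¹ ≡ ℕ→ℚ (k !) ⁻¹ *ℚ ℕ→ℚ ((n ∸ k) !) ⁻¹
binomial÷factorial {n} {k} k≤n = begin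
  B *ℚ ℕ→ℚ (n !) ⁻¹                ≡⟨ cong (λ x → B *ℚ x ⁻¹) n!≡ ⟨
  B *ℚ (B *ℚ (K *ℚ L)) ⁻¹          ≡⟨ cong (B *ℚ_) (trans (⁻¹-*-distrib B (K *ℚ L)) (cong (B ⁻¹ *ℚ_) (⁻¹-*-distrib K L))) ⟩
  B *ℚ (B ⁻¹ *ℚ (K ⁻¹ *ℚ L ⁻¹))    ≡⟨ ℚ.*-assoc B (B ⁻¹) _ ⟨
  (B *ℚ B ⁻¹) *ℚ (K ⁻¹ *ℚ L ⁻¹)    ≡⟨ cong (_*ℚ (K ⁻¹ *ℚ L ⁻¹)) (⁻¹-inverseʳ (ℕ→ℚ-≢0 nCk≢0)) ⟩
  1ℚ *ℚ (K ⁻¹ *ℚ L ⁻¹)             ≡⟨ ℚ.*-identityˡ _ ⟩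
  K ⁻¹ *ℚ L ⁻¹                     ∎
  where
  open ≡-Reasoning
  B = ℕ→ℚ (n C k)
  K = ℕ→ℚ (k !)
  L = ℕ→ℚ ((n ∸ k) !)
  n!≡ : B *ℚ (K *ℚ L) ≡ ℕ→ℚ (n !)
  n!≡ = trans (cong (B *ℚ_) (sym (ℕ→ℚ-homo-* (k !) _)))
              (trans (sym (ℕ→ℚ-homo-* (n C k) _)) (cong ℕ→ℚ (binomial*factorials≡factorial k≤n)))
  nCk≢0 : n C k ≢ 0
  nCk≢0 nCk≡0 = ℕ.<⇒≢ (ℕ.1≤n! n)
    (sym (trans (sym (binomial*factorials≡factorial k≤n)) (cong (_* (k ! * (n ∸ k) !)) nCk≡0)))

module Normalisation (b : ℕ → ℕ) (b₀≡0 : b 0 ≡ 0) (p : ℕ) (0<p : 0 < p)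
  (seqCount-off-pℕ : ∀ n → ¬ (p ∣ n) → seqCount b n ≡ 0) where

  b-off-pℕ : ∀ k → ¬ (p ∣ k) → b k ≡ 0
  b-off-pℕ k p∤k = ℕ.n≤0⇒n≡0 (subst (b k ≤_) (seqCount-off-pℕ k p∤k) (count≤seqCount b₀≡0 k))

  normalised : (ℕ → ℕ) → ℕ → ℚ
  normalised a j = ℕ→ℚ (a (p * j)) ÷' ℕ→ℚ ((p * j) !)

  β : ℕ → ℚ
  β = normalised b

  normalised-labelledProduct : ∀ h j →
    normalised (labelledProduct b h) j ≡ Σ< (suc j) (λ i → β i *ℚ normalised h (j ∸ i))
  normalised-labelledProduct h j = begin
    ℕ→ℚ (sumTo n T) ÷' F                          ≡⟨ trans (÷'≡*⁻¹ _ F) (ℚ.*-comm _ (F ⁻¹)) ⟩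
    F ⁻¹ *ℚ ℕ→ℚ (sumTo n T)                       ≡⟨ cong (F ⁻¹ *ℚ_) (ℕ→ℚ-sumTo n T) ⟩
    F ⁻¹ *ℚ Σ< (suc n) (λ k → ℕ→ℚ (T k))          ≡⟨ *-distribˡ-Σ< (suc n) (F ⁻¹) _ ⟩
    Σ< (suc n) (λ k → F ⁻¹ *ℚ ℕ→ℚ (T k))          ≡⟨ Σ<-multiples 0<p j _ off-pℕ≡0 ⟩
    Σ< (suc j) (λ i → F ⁻¹ *ℚ ℕ→ℚ (T (p * i)))    ≡⟨ Σ<-cong (suc j) (λ i i<1+j → term≡ (ℕ.≤-pred i<1+j)) ⟩
    Σ< (suc j) (λ i → β i *ℚ normalised h (j ∸ i)) ∎
    where
    open ≡-Reasoning
    n = p * j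
    F = ℕ→ℚ (n !)
    T = λ k → (n C k) * b k * h (n ∸ k)
    off-pℕ≡0 : ∀ k → ¬ (p ∣ k) → F ⁻¹ *ℚ ℕ→ℚ (T k) ≡ 0ℚ
    off-pℕ≡0 k p∤k rewrite b-off-pℕ k p∤k | ℕ.*-zeroʳ (n C k) = ℚ.*-zeroʳ (F ⁻¹)
    term≡ : ∀ {i} → i ≤ j → F ⁻¹ *ℚ ℕ→ℚ (T (p * i)) ≡ β i *ℚ normalised h (j ∸ i)
    term≡ {i} i≤j = begin
      F ⁻¹ *ℚ ℕ→ℚ ((n C k) * b k * h (n ∸ k))
        ≡⟨ cong (F ⁻¹ *ℚ_) (trans (ℕ→ℚ-homo-* ((n C k) * b k) (h (n ∸ k)))
                                  (cong (_*ℚ ℕ→ℚ (h (n ∸ k))) (ℕ→ℚ-homo-* (n C k) (b k)))) ⟩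
      F ⁻¹ *ℚ (ℕ→ℚ (n C k) *ℚ ℕ→ℚ (b k) *ℚ ℕ→ℚ (h (n ∸ k)))
        ≡⟨ regroup (F ⁻¹) (ℕ→ℚ (n C k)) (ℕ→ℚ (b k)) (ℕ→ℚ (h (n ∸ k))) ⟩
      (ℕ→ℚ (n C k) *ℚ F ⁻¹) *ℚ (ℕ→ℚ (b k) *ℚ ℕ→ℚ (h (n ∸ k)))
        ≡⟨ cong (_*ℚ (ℕ→ℚ (b k) *ℚ ℕ→ℚ (h (n ∸ k)))) (binomial÷factorial (ℕ.*-monoʳ-≤ p i≤j)) ⟩
      (ℕ→ℚ (k !) ⁻¹ *ℚ ℕ→ℚ ((n ∸ k) !) ⁻¹) *ℚ (ℕ→ℚ (b k) *ℚ ℕ→ℚ (h (n ∸ k)))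
        ≡⟨ regroup′ (ℕ→ℚ (k !) ⁻¹) (ℕ→ℚ ((n ∸ k) !) ⁻¹) (ℕ→ℚ (b k)) (ℕ→ℚ (h (n ∸ k))) ⟩
      (ℕ→ℚ (b k) *ℚ ℕ→ℚ (k !) ⁻¹) *ℚ (ℕ→ℚ (h (n ∸ k)) *ℚ ℕ→ℚ ((n ∸ k) !) ⁻¹)
        ≡⟨ cong₂ _*ℚ_ (÷'≡*⁻¹ (ℕ→ℚ (b k)) (ℕ→ℚ (k !)))
                      (trans (cong (λ l → ℕ→ℚ (h l) ÷' ℕ→ℚ (l !)) (sym n∸k≡)) (÷'≡*⁻¹ (ℕ→ℚ (h (n ∸ k))) (ℕ→ℚ ((n ∸ k) !)))) ⟨
      β i *ℚ normalised h (j ∸ i)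
        ∎
      where
      k = p * i
      n∸k≡ : n ∸ k ≡ p * (j ∸ i)
      n∸k≡ = sym (ℕ.*-distribˡ-∸ p j i)
      regroup : ∀ f c x y → f *ℚ (c *ℚ x *ℚ y) ≡ (c *ℚ f) *ℚ (x *ℚ y)
      regroup = solve 4 (λ f c x y → f :* (c :* x :* y) := (c :* f) :* (x :* y)) refl
      regroup′ : ∀ a d x y → (a *ℚ d) *ℚ (x *ℚ y) ≡ (x *ℚ a) *ℚ (y *ℚ d)
      regroup′ = solve 4 (λ a d x y → (a :* d) :* (x :* y) := (x :* a) :* (y :* d)) refl

  0<p*suc : ∀ j → 0 < p * suc j
  0<p*suc j = ℕ.<-≤-trans 0<p (ℕ.m≤m*n p (suc j))

  powCount-normalised : ∀ m j → normalised (powCount b m) j ≡ convPow β m j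
  powCount-normalised zero    zero    rewrite ℕ.*-zeroʳ p = refl
  powCount-normalised zero    (suc j) = begin
    ℕ→ℚ (powCount b 0 (p * suc j)) ÷' F   ≡⟨ cong (λ a → ℕ→ℚ a ÷' F) (powCount₀-vanishes (0<p*suc j)) ⟩
    0ℚ ÷' F                               ≡⟨ ÷'≡*⁻¹ 0ℚ F ⟩
    0ℚ *ℚ F ⁻¹                            ≡⟨ ℚ.*-zeroˡ (F ⁻¹) ⟩
    0ℚ                                    ∎
    where
    open ≡-Reasoning
    F = ℕ→ℚ ((p * suc j) !)
    powCount₀-vanishes : ∀ {n} → 0 < n → powCount b 0 n ≡ 0
    powCount₀-vanishes {suc n} _ = refl
  powCount-normalised (suc m) j       = trans (normalised-labelledProduct (powCount b m) j)
    (Σ<-cong (suc j) λ i _ → cong (β i *ℚ_) (powCount-normalised m (j ∸ i)))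

  s : ℕ → ℚ
  s = normalised (seqCount b)

  s-rec : ∀ j → s (suc j) ≡ Σ< (suc (suc j)) (λ i → β i *ℚ s (suc j ∸ i))
  s-rec j = trans (cong (λ a → ℕ→ℚ a ÷' ℕ→ℚ ((p * suc j) !)) (seqCount≡labelledProduct b₀≡0 (0<p*suc j)))
                  (normalised-labelledProduct (seqCount b) (suc j))

  β₀≡0 : β 0 ≡ 0ℚ
  β₀≡0 rewrite ℕ.*-zeroʳ p | b₀≡0 = refl

  s₀≡1 : s 0 ≡ 1ℚ
  s₀≡1 rewrite ℕ.*-zeroʳ p = refl

  0≤normalised : ∀ a j → 0ℚ ≤ℚ normalised a j
  0≤normalised a j = subst (0ℚ ≤ℚ_) (sym (÷'≡*⁻¹ (ℕ→ℚ (a (p * j))) (ℕ→ℚ ((p * j) !))))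
    (*-nonneg (ℕ→ℚ-nonneg (a (p * j))) (⁻¹-nonneg (ℕ→ℚ-nonneg ((p * j) !))))

  0<s₁ : seqCount b p ≢ 0 → 0ℚ <ℚ s 1
  0<s₁ aₚ≢0 = subst (0ℚ <ℚ_) (sym (÷'≡*⁻¹ (ℕ→ℚ (seqCount b (p * 1))) (ℕ→ℚ ((p * 1) !))))
    (*-pos (ℕ→ℚ-pos (ℕ.n≢0⇒n>0 (subst (λ n → seqCount b n ≢ 0) (sym (ℕ.*-identityʳ p)) aₚ≢0)))
           (⁻¹-pos (ℕ→ℚ-pos (ℕ.1≤n! (p * 1)))))

-- Irreducible parts

factorial-+-≤ : ∀ a d → (a + d) ! ≤ (a + d) ^ d * a !
factorial-+-≤ a zero    rewrite ℕ.+-identityʳ a = ℕ.≤-reflexive (sym (ℕ.+-identityʳ (a !)))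
factorial-+-≤ a (suc d) rewrite ℕ.+-suc a d = begin
  suc (a + d) * (a + d) !                      ≤⟨ ℕ.*-monoʳ-≤ (suc (a + d)) (factorial-+-≤ a d) ⟩
  suc (a + d) * ((a + d) ^ d * a !)            ≤⟨ ℕ.*-monoʳ-≤ (suc (a + d)) (ℕ.*-monoˡ-≤ (a !) (ℕ.^-monoˡ-≤ d (ℕ.n≤1+n (a + d)))) ⟩
  suc (a + d) * (suc (a + d) ^ d * a !)        ≡⟨ ℕ.*-assoc (suc (a + d)) (suc (a + d) ^ d) (a !) ⟨
  suc (a + d) * suc (a + d) ^ d * a !          ∎
  where open ℕ.≤-Reasoning

^-distribʳ-* : ∀ m n o → (m * n) ^ o ≡ m ^ o * n ^ o
^-distribʳ-* m n zero    = refl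
^-distribʳ-* m n (suc o) = trans (cong (m * n *_) (^-distribʳ-* m n o)) (*-interchange m n (m ^ o) (n ^ o))

÷'-≤ : ∀ {x y m} → 0 < y → x ≤ m * y → ℕ→ℚ x ÷' ℕ→ℚ y ≤ℚ ℕ→ℚ m
÷'-≤ {x} {y} {m} 0<y x≤m*y = begin
  ℕ→ℚ x ÷' Y               ≡⟨ ÷'≡*⁻¹ (ℕ→ℚ x) Y ⟩
  ℕ→ℚ x *ℚ Y ⁻¹            ≤⟨ *-monoʳ-≤-nonneg (⁻¹-nonneg (ℕ→ℚ-nonneg y)) (ℕ→ℚ-mono-≤ x≤m*y) ⟩
  ℕ→ℚ (m * y) *ℚ Y ⁻¹      ≡⟨ cong (_*ℚ Y ⁻¹) (ℕ→ℚ-homo-* m y) ⟩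
  ℕ→ℚ m *ℚ Y *ℚ Y ⁻¹       ≡⟨ ℚ.*-assoc (ℕ→ℚ m) Y (Y ⁻¹) ⟩
  ℕ→ℚ m *ℚ (Y *ℚ Y ⁻¹)     ≡⟨ cong (ℕ→ℚ m *ℚ_) (⁻¹-inverseʳ (ℕ→ℚ-≢0 (ℕ.>⇒≢ 0<y))) ⟩
  ℕ→ℚ m *ℚ 1ℚ              ≡⟨ ℚ.*-identityʳ (ℕ→ℚ m) ⟩
  ℕ→ℚ m                    ∎
  where
  open ℚ.≤-Reasoning
  Y = ℕ→ℚ y

÷'-through : ∀ x y {z} → z ≢ 0ℚ → x ÷' y ≡ (x ÷' z) *ℚ (z ÷' y)
÷'-through x y {z} z≢0 = begin
  x ÷' y                      ≡⟨ ÷'≡*⁻¹ x y ⟩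
  x *ℚ y ⁻¹                   ≡⟨ cong (_*ℚ y ⁻¹) (ℚ.*-identityʳ x) ⟨
  x *ℚ 1ℚ *ℚ y ⁻¹             ≡⟨ cong (λ u → x *ℚ u *ℚ y ⁻¹) (trans (ℚ.*-comm (z ⁻¹) z) (⁻¹-inverseʳ z≢0)) ⟨
  x *ℚ (z ⁻¹ *ℚ z) *ℚ y ⁻¹    ≡⟨ solve 4 (λ a b c d → a :* (b :* c) :* d := a :* b :* (c :* d)) refl x (z ⁻¹) z (y ⁻¹) ⟩
  x *ℚ z ⁻¹ *ℚ (z *ℚ y ⁻¹)    ≡⟨ cong₂ _*ℚ_ (÷'≡*⁻¹ x z) (÷'≡*⁻¹ z y) ⟨
  (x ÷' z) *ℚ (z ÷' y)        ∎
  where open ≡-Reasoning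

module IrreducibleParts
  (b : ℕ → ℕ) (b₀≡0 : b 0 ≡ 0) (p : ℕ) (0<p : 0 < p)
  (seqCount-off-pℕ : ∀ n → ¬ (p ∣ n) → seqCount b n ≡ 0)
  (gargantuan : GargantuanSums (λ n → ℕ→ℚ (seqCount b (p * n)) ÷' ℕ→ℚ ((p * n) !)))
  (aₚ≢0 : seqCount b p ≢ 0) (k : ℕ)
  where

  open Normalisation b b₀≡0 p 0<p seqCount-off-pℕ
  open ConvolutionAsymptotics β s β₀≡0 (0≤normalised b) s₀≡1 (0≤normalised (seqCount b)) (0<s₁ aₚ≢0)
                              s-rec gargantuan

  scale : ℕ → ℚ
  scale n = ℕ→ℚ ((p * n) !) ÷' ℕ→ℚ (seqCount b (p * n))

  0≤scale : ∀ n → 0ℚ ≤ℚ scale n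
  0≤scale n = subst (0ℚ ≤ℚ_) (sym (÷'≡*⁻¹ (ℕ→ℚ ((p * n) !)) (ℕ→ℚ (seqCount b (p * n)))))
    (*-nonneg (ℕ→ℚ-nonneg ((p * n) !)) (⁻¹-nonneg (ℕ→ℚ-nonneg (seqCount b (p * n)))))

  -- The difference estimated in the theorem for m = suc k, with n ∸ m + 1 generalised to r.
  deviation : ℕ → ℕ → ℚ
  deviation n r = (ℕ→ℚ (powCount b (suc k) (p * n)) ÷' ℕ→ℚ (seqCount b (p * n)))
    -ℚ ((ℕ→ℚ (suc k * (p * n) !) ÷' ℕ→ℚ ((p !) ^ k * (p * r) !))
        *ℚ (ℕ→ℚ (seqCount b p ^ k * seqCount b (p * r)) ÷' ℕ→ℚ (seqCount b (p * n))))

  e : ℕ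
  e = p * suc k

  errorScale : ℕ → ℕ → ℚ
  errorScale n r = ℕ→ℚ (n ^ e) *ℚ (ℕ→ℚ (seqCount b (p * r)) ÷' ℕ→ℚ (seqCount b (p * n)))

  mainTerm*scale≡ : ∀ t →
    mainTerm k t *ℚ scale (suc k + t) ≡
    (ℕ→ℚ (suc k * (p * (suc k + t)) !) ÷' ℕ→ℚ ((p !) ^ k * (p * suc t) !))
      *ℚ (ℕ→ℚ (seqCount b p ^ k * seqCount b (p * suc t)) ÷' ℕ→ℚ (seqCount b (p * (suc k + t))))
  mainTerm*scale≡ t = sym (begin
    (Z ÷' W) *ℚ (V ÷' Y)                                   ≡⟨ cong₂ _*ℚ_ (÷'≡*⁻¹ Z W) (÷'≡*⁻¹ V Y) ⟩
    Z *ℚ W ⁻¹ *ℚ (V *ℚ Y ⁻¹)                               ≡⟨ cong₂ (λ u v → u *ℚ v) (cong₂ _*ℚ_ Z≡ W⁻¹≡) (cong (_*ℚ Y ⁻¹) V≡) ⟩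
    K *ℚ F *ℚ (P ⁻¹ ^ℚ k *ℚ F₁ ⁻¹) *ℚ (A ^ℚ k *ℚ A₁ *ℚ Y ⁻¹)
      ≡⟨ solve 7 (λ K F Pᵏ F₁ Aᵏ A₁ Y → K :* F :* (Pᵏ :* F₁) :* (Aᵏ :* A₁ :* Y)
                                     := K :* (Aᵏ :* Pᵏ) :* (A₁ :* F₁) :* (F :* Y))
                 refl K F (P ⁻¹ ^ℚ k) (F₁ ⁻¹) (A ^ℚ k) A₁ (Y ⁻¹) ⟩
    K *ℚ (A ^ℚ k *ℚ P ⁻¹ ^ℚ k) *ℚ (A₁ *ℚ F₁ ⁻¹) *ℚ (F *ℚ Y ⁻¹)
      ≡⟨ cong₂ _*ℚ_ (cong₂ (λ u v → K *ℚ u *ℚ v) Aᵏ/Pᵏ≡cᵏ (sym (÷'≡*⁻¹ A₁ F₁))) (sym (÷'≡*⁻¹ F Y)) ⟩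
    K *ℚ c ^ℚ k *ℚ s (suc t) *ℚ scale n                     ∎)
    where
    open ≡-Reasoning
    n = suc k + t
    K = ℕ→ℚ (suc k)
    F = ℕ→ℚ ((p * n) !)
    P = ℕ→ℚ (p !)
    F₁ = ℕ→ℚ ((p * suc t) !)
    A = ℕ→ℚ (seqCount b p)
    A₁ = ℕ→ℚ (seqCount b (p * suc t))
    Y = ℕ→ℚ (seqCount b (p * n))
    Z = ℕ→ℚ (suc k * (p * n) !)
    W = ℕ→ℚ ((p !) ^ k * (p * suc t) !)
    V = ℕ→ℚ (seqCount b p ^ k * seqCount b (p * suc t))
    Z≡ : Z ≡ K *ℚ F
    Z≡ = ℕ→ℚ-homo-* (suc k) ((p * n) !)
    W⁻¹≡ : W ⁻¹ ≡ P ⁻¹ ^ℚ k *ℚ F₁ ⁻¹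
    W⁻¹≡ = trans (cong _⁻¹ (trans (ℕ→ℚ-homo-* ((p !) ^ k) ((p * suc t) !)) (cong (_*ℚ F₁) (ℕ→ℚ-homo-^ (p !) k))))
                 (trans (⁻¹-*-distrib (P ^ℚ k) F₁) (cong (_*ℚ F₁ ⁻¹) (⁻¹-^-distrib P k)))
    V≡ : V ≡ A ^ℚ k *ℚ A₁
    V≡ = trans (ℕ→ℚ-homo-* (seqCount b p ^ k) (seqCount b (p * suc t))) (cong (_*ℚ A₁) (ℕ→ℚ-homo-^ (seqCount b p) k))
    A/P≡c : A *ℚ P ⁻¹ ≡ c
    A/P≡c = trans (sym (÷'≡*⁻¹ A P))
                  (trans (cong (λ q → ℕ→ℚ (seqCount b q) ÷' ℕ→ℚ (q !)) (sym (ℕ.*-identityʳ p))) s₁≡c)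
    Aᵏ/Pᵏ≡cᵏ : A ^ℚ k *ℚ P ⁻¹ ^ℚ k ≡ c ^ℚ k
    Aᵏ/Pᵏ≡cᵏ = trans (sym (^ℚ-distrib-* A (P ⁻¹) k)) (cong (_^ℚ k) A/P≡c)

  error*scale≡deviation : ∀ t → error k t *ℚ scale (suc k + t) ≡ deviation (suc k + t) (suc t)
  error*scale≡deviation t = begin
    (convPow β (suc k) n -ℚ mainTerm k t) *ℚ scale n
      ≡⟨ solve 3 (λ a m w → (a :- m) :* w := a :* w :- m :* w) refl (convPow β (suc k) n) (mainTerm k t) (scale n) ⟩
    convPow β (suc k) n *ℚ scale n -ℚ mainTerm k t *ℚ scale n
      ≡⟨ cong₂ _-ℚ_ convPow*scale≡ (mainTerm*scale≡ t) ⟩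
    deviation n (suc t)
      ∎
    where
    open ≡-Reasoning
    n = suc k + t
    convPow*scale≡ : convPow β (suc k) n *ℚ scale n ≡ ℕ→ℚ (powCount b (suc k) (p * n)) ÷' ℕ→ℚ (seqCount b (p * n))
    convPow*scale≡ = sym (trans (÷'-through (ℕ→ℚ (powCount b (suc k) (p * n))) (ℕ→ℚ (seqCount b (p * n)))
                                             (ℕ→ℚ-≢0 (ℕ.>⇒≢ (ℕ.1≤n! (p * n)))))
                                (cong (_*ℚ scale n) (powCount-normalised (suc k) n)))

  s*scale≤errorScale : ∀ t → s t *ℚ scale (suc k + t) ≤ℚ ℕ→ℚ (p ^ e) *ℚ errorScale (suc k + t) t
  s*scale≤errorScale t = begin
    (Aₜ ÷' Gₜ) *ℚ (F ÷' Y)                           ≡⟨ cong₂ _*ℚ_ (÷'≡*⁻¹ Aₜ Gₜ) (÷'≡*⁻¹ F Y) ⟩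
    Aₜ *ℚ Gₜ ⁻¹ *ℚ (F *ℚ Y ⁻¹)                        ≡⟨ swap-middle Aₜ (Gₜ ⁻¹) F (Y ⁻¹) ⟩
    Aₜ *ℚ Y ⁻¹ *ℚ (F *ℚ Gₜ ⁻¹)                        ≡⟨ cong (Aₜ *ℚ Y ⁻¹ *ℚ_) (÷'≡*⁻¹ F Gₜ) ⟨
    Aₜ *ℚ Y ⁻¹ *ℚ (F ÷' Gₜ)                           ≤⟨ *-monoˡ-≤-nonneg 0≤Aₜ/Y (÷'-≤ {m = p ^ e * n ^ e} (ℕ.1≤n! (p * t)) factorials≤) ⟩
    Aₜ *ℚ Y ⁻¹ *ℚ ℕ→ℚ (p ^ e * n ^ e)                 ≡⟨ cong (Aₜ *ℚ Y ⁻¹ *ℚ_) (ℕ→ℚ-homo-* (p ^ e) (n ^ e)) ⟩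
    Aₜ *ℚ Y ⁻¹ *ℚ (ℕ→ℚ (p ^ e) *ℚ ℕ→ℚ (n ^ e))        ≡⟨ rotate (Aₜ *ℚ Y ⁻¹) (ℕ→ℚ (p ^ e)) (ℕ→ℚ (n ^ e)) ⟩
    ℕ→ℚ (p ^ e) *ℚ (ℕ→ℚ (n ^ e) *ℚ (Aₜ *ℚ Y ⁻¹))      ≡⟨ cong (λ u → ℕ→ℚ (p ^ e) *ℚ (ℕ→ℚ (n ^ e) *ℚ u)) (÷'≡*⁻¹ Aₜ Y) ⟨
    ℕ→ℚ (p ^ e) *ℚ (ℕ→ℚ (n ^ e) *ℚ (Aₜ ÷' Y))         ∎
    where
    open ℚ.≤-Reasoning
    n = suc k + t
    Aₜ = ℕ→ℚ (seqCount b (p * t))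
    Gₜ = ℕ→ℚ ((p * t) !)
    F = ℕ→ℚ ((p * n) !)
    Y = ℕ→ℚ (seqCount b (p * n))
    swap-middle : ∀ a g f y → a *ℚ g *ℚ (f *ℚ y) ≡ a *ℚ y *ℚ (f *ℚ g)
    swap-middle = solve 4 (λ a g f y → a :* g :* (f :* y) := a :* y :* (f :* g)) refl
    rotate : ∀ q a b → q *ℚ (a *ℚ b) ≡ a *ℚ (b *ℚ q)
    rotate = solve 3 (λ q a b → q :* (a :* b) := a :* (b :* q)) refl
    0≤Aₜ/Y : 0ℚ ≤ℚ Aₜ *ℚ Y ⁻¹
    0≤Aₜ/Y = *-nonneg (ℕ→ℚ-nonneg (seqCount b (p * t))) (⁻¹-nonneg (ℕ→ℚ-nonneg (seqCount b (p * n))))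
    pt+e≡pn : p * t + e ≡ p * n
    pt+e≡pn = trans (ℕ.+-comm (p * t) e) (sym (ℕ.*-distribˡ-+ p (suc k) t))
    factorials≤ : (p * n) ! ≤ (p ^ e * n ^ e) * (p * t) !
    factorials≤ = subst₂ _≤_ (cong _! pt+e≡pn)
                    (cong (_* (p * t) !) (trans (cong (_^ e) pt+e≡pn) (^-distribʳ-* p n e)))
                    (factorial-+-≤ (p * t) e)

  deviation=O : (λ n → deviation n (n ∸ suc k + 1)) =O (λ n → errorScale n (n ∸ suc k))
  deviation=O = =O-unshift (suc k)
    (=O-cong deviation≡ (=O-trans (=O-*ʳ (λ t → 0≤scale (suc k + t)) (error=Os k)) s*scale=O))
    where
    deviation≡ : ∀ t → error k t *ℚ scale (suc k + t) ≡ deviation (suc k + t) (suc k + t ∸ suc k + 1)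
    deviation≡ t = trans (error*scale≡deviation t)
                         (cong (deviation (suc k + t)) (sym (trans (cong (_+ 1) (ℕ.m+n∸m≡n (suc k) t)) (ℕ.+-comm t 1))))
    s*scale=O : (λ t → s t *ℚ scale (suc k + t)) =O (λ t → errorScale (suc k + t) (suc k + t ∸ suc k))
    s*scale=O = nonneg-≤⇒=O {g = λ t → errorScale (suc k + t) (suc k + t ∸ suc k)}
                  (ℕ→ℚ (p ^ e)) (ℕ→ℚ-nonneg (p ^ e))
                  (λ t → *-nonneg (0≤normalised (seqCount b) t) (0≤scale (suc k + t)))
                  (λ t → subst (λ r → s t *ℚ scale (suc k + t) ≤ℚ ℕ→ℚ (p ^ e) *ℚ errorScale (suc k + t) r)
                               (sym (ℕ.m+n∸m≡n (suc k) t)) (s*scale≤errorScale t))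

=O⇒bounded : ∀ {f g} → f =O g → Σ ℚ λ K → Σ ℕ λ N → (n : ℕ) → n ≥ N → ∣ f n ∣ ≤ℚ K *ℚ g n
=O⇒bounded (K , _ , N , bound) = K , N , bound

corollary5p2 : (b : ℕ → ℕ) → b 0 ≡ 0 →
    (p : ℕ) → p > 0 →
    Periodic p (seqCount b) →
    Gargantuan (λ n → ℕ→ℚ (seqCount b (p * n)) ÷' ℕ→ℚ ((p * n) !)) →
    seqCount b p ≢ 0 →
    (m : ℕ) → m ≥ 1 →
    Σ ℚ λ C → Σ ℕ λ N → (n : ℕ) → n ≥ N →
      ∣ (ℕ→ℚ (powCount b m (p * n)) ÷' ℕ→ℚ (seqCount b (p * n)))
        -ℚ ((ℕ→ℚ (m * (p * n) !) ÷' ℕ→ℚ ((p !) ^ (m ∸ 1) * (p * (n ∸ m + 1)) !))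
            *ℚ (ℕ→ℚ (seqCount b p ^ (m ∸ 1) * seqCount b (p * (n ∸ m + 1)))
                ÷' ℕ→ℚ (seqCount b (p * n)))) ∣
      ≤ℚ C *ℚ (ℕ→ℚ (n ^ (p * m)) *ℚ
               (ℕ→ℚ (seqCount b (p * (n ∸ m))) ÷' ℕ→ℚ (seqCount b (p * n))))
corollary5p2 b b₀≡0 p 0<p (_ , off-pℕ) gargantuan aₚ≢0 zero    ()
corollary5p2 b b₀≡0 p 0<p (_ , off-pℕ) gargantuan aₚ≢0 (suc k) _  = =O⇒bounded deviation=O
  where open IrreducibleParts b b₀≡0 p 0<p off-pℕ (proj₂ gargantuan) aₚ≢0 k
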